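{- Let $M$ be a loopless matroid. For each $\mathcal{F} \in \mathcal{N}^\circ(M)$, \[ \overline{P}_M^\mathcal{F}(q^{ -1}) = q^{ -(\operatorname{rk} M - 1 - \# \mathcal{F})} \overline{P}_M^\mathcal{F}(q) \in \mathbb{Z}[q^{\pm 1}]. \]
   Context: Let $M$ be a matroid on ground set $E$ with lattice of flats $\mathcal{L}$; $\overline{\chi}_N=\chi_N/(q-1)$ is the reduced characteristic polynomial. $\mathcal{N}(M)$ is the set of flags of flats strictly containing $\operatorname{cl}(\emptyset)$, and $\mathcal{N}^\circ(M)$ the flags not containing $E$. For a flag $\mathcal{G}$, $M_\mathcal{G}$ is the matroid $M_w$ for $w$ in the relative interior of the cone spanned by the indicator vectors of flats in $\mathcal{G}$ ($M_w$ having as bases the bases $B$ of $M$ maximizing $\sum_{e\in B}w_e$); for loopless $M$, $M_\mathcal{G}=\bigoplus_{G\in\mathcal{G}\cup\{E\}}M|G/z(G)$, $z(G)$ the largest flat of $\mathcal{G}$ strictly below $G$ (or $\emptyset$). The Poincaré polynomial of $M$ at $\mathcal{F}\in\mathcal{N}^\circ(M)$ is $\overline{P}_M^\mathcal{F}(q)=\sum_{\mathcal{G}\in\mathcal{N}^\circ(M),\,\mathcal{G}\supseteq\mathcal{F}}\overline{\chi}_{M_\mathcal{G}}(q)/(q-1)^{\#\mathcal{G}}\in\mathbb{Z}[q]$, a polynomial of degree $\operatorname{rk}M-1-\#\mathcal{F}$. -}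

module Defs where

open import Data.Nat as ℕ using (ℕ; zero; suc; _<_; _≤_)
open import Data.Nat.Properties as ℕP using (_<?_)
open import Data.Bool using (Bool; true; false)
import Data.Bool.Properties as BoolP
open import Data.Fin using (Fin)
import Data.Fin.Properties as FinP
open import Data.Fin.Subset using (Subset; _∪_; _∩_; ∁; ⁅_⁆; ⊥; ⊤; ⋃; _∈_; _∉_; _⊆_; _⊂_; ∣_∣)
open import Data.Fin.Subset.Properties using (_∈?_; _⊂?_)
open import Data.Vec using (Vec; []; _∷_; tabulate)
import Data.Vec.Properties as VecP
open import Data.List using (List; []; _∷_; _++_; map; foldr; filter; length)
open import Data.List.Relation.Unary.All using (All; all?)
open import Data.List.Relation.Unary.AllPairs using (AllPairs; allPairs?)
open import Data.List.Membership.DecPropositional using ()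
import Data.List.Membership.DecPropositional as DecMem
open import Data.Sum using (_⊎_)
open import Data.Product using (_×_)
open import Data.Rational as ℚ using (ℚ; 0ℚ; 1ℚ; _+_; _*_; _-_; -_; _÷_)
import Data.Rational.Properties as ℚP
open import Relation.Binary.PropositionalEquality using (_≡_; _≢_)
open import Relation.Nullary using (¬_; Dec; yes; no)
open import Relation.Nullary.Decidable using (_×-dec_; _⊎-dec_; _→-dec_; ¬?; ⌊_⌋)

-- Matroids on the ground set E = Fin n, given by rank functions

record Matroid (n : ℕ) : Set where
  field
    rank       : Subset n → ℕ
    rank-bound : ∀ X → rank X ≤ ∣ X ∣
    rank-mono  : ∀ X Y → X ⊆ Y → rank X ≤ rank Y
    rank-submod : ∀ X Y → rank (X ∪ Y) ℕ.+ rank (X ∩ Y) ≤ rank X ℕ.+ rank Y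
open Matroid public

module _ {n : ℕ} where

  rk : Matroid n → ℕ
  rk M = rank M ⊤

  Loopless : Matroid n → Set
  Loopless M = ∀ (e : Fin n) → rank M ⁅ e ⁆ ≡ 1

  cl : Matroid n → Subset n → Subset n
  cl M X = tabulate (λ e → ⌊ rank M (X ∪ ⁅ e ⁆) ℕ.≟ rank M X ⌋)

  IsFlat : Matroid n → Subset n → Set
  IsFlat M X = ∀ (e : Fin n) → e ∉ X → rank M X < rank M (X ∪ ⁅ e ⁆)

  isFlat? : (M : Matroid n) → (X : Subset n) → Dec (IsFlat M X)
  isFlat? M X = FinP.all? (λ e → ¬? (e ∈? X) →-dec (rank M X <? rank M (X ∪ ⁅ e ⁆)))

  _≟ₛ_ : (X Y : Subset n) → Dec (X ≡ Y)
  _≟ₛ_ = VecP.≡-dec BoolP._≟_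

  -- flats occurring in flags of N°(M): flats F with cl(∅) ⊊ F and F ≠ E
  IsNFlat : Matroid n → Subset n → Set
  IsNFlat M F = IsFlat M F × (cl M ⊥ ⊂ F) × (F ≢ ⊤)

  isNFlat? : (M : Matroid n) → (F : Subset n) → Dec (IsNFlat M F)
  isNFlat? M F = isFlat? M F ×-dec ((cl M ⊥ ⊂? F) ×-dec ¬? (F ≟ₛ ⊤))

  Comparable : Subset n → Subset n → Set
  Comparable A B = (A ⊂ B) ⊎ (B ⊂ A)

  -- A flag in N°(M), represented by a duplicate-free list of its flats
  -- (pairwise strictly comparable, hence a chain).
  IsFlagᵒ : Matroid n → List (Subset n) → Set
  IsFlagᵒ M 𝓕 = All (IsNFlat M) 𝓕 × AllPairs Comparable 𝓕

allSubsets : (n : ℕ) → List (Subset n)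
allSubsets zero = [] ∷ []
allSubsets (suc n) = map (true ∷_) (allSubsets n) ++ map (false ∷_) (allSubsets n)

sublists : {A : Set} → List A → List (List A)
sublists [] = [] ∷ []
sublists (x ∷ xs) = map (x ∷_) (sublists xs) ++ sublists xs

module _ {n : ℕ} where
  open DecMem (_≟ₛ_ {n}) using () renaming (_∈_ to _∈ₗ_; _∈?_ to _∈ₗ?_)

  nFlats : Matroid n → List (Subset n)
  nFlats M = filter (isNFlat? M) (allSubsets n)

  flagsAbove : Matroid n → List (Subset n) → List (List (Subset n))
  flagsAbove M 𝓕 =
    filter (λ 𝓖 → allPairs? (λ A B → (A ⊂? B) ⊎-dec (B ⊂? A)) 𝓖
                   ×-dec all? (λ F → F ∈ₗ? 𝓖) 𝓕)
           (sublists (nFlats M))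

-- The matroid M_𝓖 (for loopless M), via its rank function:
-- M_𝓖 = ⊕_{G ∈ 𝓖 ∪ {E}} M|G / z(G)

module _ {n : ℕ} where

  -- z(G): the largest flat of 𝓖 strictly below G (∅ if none); since 𝓖 is a
  -- chain, this is the union of the members of 𝓖 strictly contained in G.
  zbelow : List (Subset n) → Subset n → Subset n
  zbelow 𝓖 G = ⋃ (filter (λ H → H ⊂? G) 𝓖)

  -- rank function of the minor M|G / Z on ground set G \ Z:
  -- r_{M|G/Z}(Y) = r(Y ∪ Z) - r(Z)   (Y ⊆ G \ Z)
  minorRank : Matroid n → Subset n → Subset n → Subset n → ℕ
  minorRank M G Z Y = rank M (Y ∪ Z) ℕ.∸ rank M Z

  -- rank function of M_𝓖 = direct sum over G ∈ 𝓖 ∪ {E} of M|G / z(G),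
  -- whose ground sets G \ z(G) partition E.
  rankFlagMatroid : Matroid n → List (Subset n) → Subset n → ℕ
  rankFlagMatroid M 𝓖 X =
    foldr ℕ._+_ 0
      (map (λ G → let Z = zbelow 𝓖 G in minorRank M G Z (X ∩ (G ∩ ∁ Z)))
           (𝓖 ++ (⊤ ∷ [])))

sumℚ : List ℚ → ℚ
sumℚ = foldr _+_ 0ℚ

_^ℚ_ : ℚ → ℕ → ℚ
q ^ℚ zero = 1ℚ
q ^ℚ suc k = q * (q ^ℚ k)

-- total division (p / q when q ≠ 0; only used with nonzero denominators)
_/ℚ_ : ℚ → ℚ → ℚ
p /ℚ q with q ℚP.≟ 0ℚ
... | yes _  = 0ℚ
... | no q≢0 = _÷_ p q {{ℚ.≢-nonZero q≢0}}

-- Characteristic polynomials (evaluated at q ∈ ℚ), for a matroid on Fin n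
-- given by its rank function r:
--   χ(q) = Σ_{X ⊆ E} (-1)^{|X|} q^{r(E) - r(X)}

module _ {n : ℕ} where

  charPolyRank : (Subset n → ℕ) → ℚ → ℚ
  charPolyRank r q =
    sumℚ (map (λ X → ((- 1ℚ) ^ℚ ∣ X ∣) * (q ^ℚ (r ⊤ ℕ.∸ r X))) (allSubsets n))

  redCharPolyRank : (Subset n → ℕ) → ℚ → ℚ
  redCharPolyRank r q = charPolyRank r q /ℚ (q - 1ℚ)

  -- Poincaré polynomial P̄_M^𝓕(q) = Σ_{𝓖 ∈ N°(M), 𝓖 ⊇ 𝓕} χ̄_{M_𝓖}(q) / (q-1)^{#𝓖}
  -- (evaluated at q ∈ ℚ, q ≠ 1)
  poincare : Matroid n → List (Subset n) → ℚ → ℚ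
  poincare M 𝓕 q =
    sumℚ (map (λ 𝓖 → redCharPolyRank (rankFlagMatroid M 𝓖) q
                      /ℚ ((q - 1ℚ) ^ℚ length 𝓖))
              (flagsAbove M 𝓕))

{-# OPTIONS --safe #-}
-- Work in the incidence algebra of the Boolean lattice of subsets of E (convolution ⋆,
-- zeta function ζ, Möbius function μ).  For s ∉ {0, 1} put χ s = μ ⋆ ζₛ, where
-- ζₛ A B = s ^ (r B - r A) for A ⊆ B, so that χ s A B is the characteristic polynomial of
-- M|B/A when A ⊆ B are flats; put χ̄ s = [A ⊂ B] χ s / (s - 1), and let P s A B be the sum
-- of χ̄ s X₀ X₁ ⋯ χ̄ s Xₖ₋₁ Xₖ over all chains A = X₀ ⊂ ⋯ ⊂ Xₖ = B, so that δ + P s is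
-- the inverse of δ - χ̄ s.  Multiplying the entry at (A, B) by s ^ (r B - r A) is an
-- automorphism of the algebra that carries χ (1/s) to the inverse of χ s (Möbius inversion
-- in disguise), and this forces s ^ (r B - r A) · P (1/s) A B = s · P s A B for A ⊂ B.
-- If B is a flat and A is not, a loop e of M/A lies in B and toggling e cancels the sum
-- defining χ s A B; hence only chains of flats contribute to P s A B between flats.
-- Finally M_𝓖 is the direct sum of the minors on the gaps of 𝓖, so P̄_M^𝓕 is the product
-- of P over the gaps of 𝓕, and the identity above, applied gap by gap, gives the theorem;
-- the exponents add up to rk M - 1 - #𝓕.

module Submission where

open import Level using (0ℓ)
open import Relation.Binary.Core using (Rel)
open import Relation.Binary.Structures using (IsDecStrictPartialOrder)
open import Relation.Binary.PropositionalEquality using (_≡_)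

module Rational where

  open import Data.Empty using (⊥-elim)
  open import Data.Nat using (zero; suc; _≤_; _∸_) renaming (_+_ to _+ℕ_)
  open import Data.Nat.Properties using (m∸n+n≡m)
  open import Data.Rational using (0ℚ; 1ℚ; _+_; _*_; _-_; -_; ≢-nonZero)
  open import Data.Rational.Properties
    using (+-*-commutativeRing; _≟_; 1≢0; *-identityˡ; *-identityʳ; *-assoc; *-comm; *-zeroˡ; *-zeroʳ; *-inverseʳ)
  open import Level using (0ℓ)
  open import Relation.Binary.PropositionalEquality
  open import Relation.Nullary using (yes; no)
  open import Relation.Nullary.Decidable using (dec⇒maybe)
  open import Tactic.RingSolver using (solve-∀) public
  open import Tactic.RingSolver.Core.AlmostCommutativeRing using (AlmostCommutativeRing; fromCommutativeRing)

  open import Defs using (_^ℚ_; _/ℚ_)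

  open ≡-Reasoning

  ℚ-ring : AlmostCommutativeRing 0ℓ 0ℓ
  ℚ-ring = fromCommutativeRing +-*-commutativeRing (λ x → dec⇒maybe (0ℚ ≟ x))

  ^-+ : ∀ x m n → x ^ℚ (m +ℕ n) ≡ (x ^ℚ m) * (x ^ℚ n)
  ^-+ x zero    n = sym (*-identityˡ _)
  ^-+ x (suc m) n = trans (cong (x *_) (^-+ x m n)) (sym (*-assoc x _ _))

  ^-distrib-* : ∀ x y n → (x * y) ^ℚ n ≡ (x ^ℚ n) * (y ^ℚ n)
  ^-distrib-* x y zero    = refl
  ^-distrib-* x y (suc n) = trans (cong ((x * y) *_) (^-distrib-* x y n)) (swap x y (x ^ℚ n) (y ^ℚ n))
    where
    swap : ∀ a b c d → (a * b) * (c * d) ≡ (a * c) * (b * d)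
    swap = solve-∀ ℚ-ring

  1^n≡1 : ∀ n → 1ℚ ^ℚ n ≡ 1ℚ
  1^n≡1 zero    = refl
  1^n≡1 (suc n) = trans (*-identityˡ _) (1^n≡1 n)

  ^-inverse : ∀ {x y} → x * y ≡ 1ℚ → ∀ n → (x ^ℚ n) * (y ^ℚ n) ≡ 1ℚ
  ^-inverse {x} {y} xy≡1 n = begin
    (x ^ℚ n) * (y ^ℚ n) ≡⟨ ^-distrib-* x y n ⟨
    (x * y) ^ℚ n        ≡⟨ cong (_^ℚ n) xy≡1 ⟩
    1ℚ ^ℚ n             ≡⟨ 1^n≡1 n ⟩
    1ℚ                  ∎

  ^-∸ : ∀ {x y} → y * x ≡ 1ℚ → ∀ {m n} → n ≤ m → x ^ℚ (m ∸ n) ≡ (x ^ℚ m) * (y ^ℚ n)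
  ^-∸ {x} {y} yx≡1 {m} {n} n≤m = begin
    x ^ℚ (m ∸ n)                          ≡⟨ *-identityʳ _ ⟨
    x ^ℚ (m ∸ n) * 1ℚ                     ≡⟨ cong (x ^ℚ (m ∸ n) *_) (^-inverse (trans (*-comm x y) yx≡1) n) ⟨
    x ^ℚ (m ∸ n) * (x ^ℚ n * y ^ℚ n)      ≡⟨ *-assoc (x ^ℚ (m ∸ n)) _ _ ⟨
    (x ^ℚ (m ∸ n) * x ^ℚ n) * y ^ℚ n      ≡⟨ cong (_* y ^ℚ n) (^-+ x (m ∸ n) n) ⟨
    x ^ℚ (m ∸ n +ℕ n) * y ^ℚ n            ≡⟨ cong (λ k → x ^ℚ k * y ^ℚ n) (m∸n+n≡m n≤m) ⟩
    x ^ℚ m * y ^ℚ n                       ∎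

  -- This also holds for y = 0, where both divisions return 0.
  /ℚ-≡-*-1/ℚ : ∀ x y → x /ℚ y ≡ x * (1ℚ /ℚ y)
  /ℚ-≡-*-1/ℚ x y with y ≟ 0ℚ
  ... | yes _ = sym (*-zeroʳ x)
  ... | no  _ = cong (x *_) (sym (*-identityˡ _))

  0/ℚ : ∀ y → 0ℚ /ℚ y ≡ 0ℚ
  0/ℚ y = trans (/ℚ-≡-*-1/ℚ 0ℚ y) (*-zeroˡ (1ℚ /ℚ y))

  *-1/ℚ : ∀ {y} → y ≢ 0ℚ → y * (1ℚ /ℚ y) ≡ 1ℚ
  *-1/ℚ {y} y≢0 with y ≟ 0ℚ
  ... | yes y≡0 = ⊥-elim (y≢0 y≡0)
  ... | no  _   = trans (cong (y *_) (*-identityˡ _)) (*-inverseʳ y {{≢-nonZero y≢0}})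

  *-cancelˡ : ∀ {z} → z ≢ 0ℚ → ∀ {x y} → z * x ≡ z * y → x ≡ y
  *-cancelˡ {z} z≢0 {x} {y} zx≡zy = begin
    x                      ≡⟨ scale x ⟨
    (z * x) * (1ℚ /ℚ z)    ≡⟨ cong (_* (1ℚ /ℚ z)) zx≡zy ⟩
    (z * y) * (1ℚ /ℚ z)    ≡⟨ scale y ⟩
    y                      ∎
    where
    scale : ∀ w → (z * w) * (1ℚ /ℚ z) ≡ w
    scale w = begin
      (z * w) * (1ℚ /ℚ z)  ≡⟨ cong (_* (1ℚ /ℚ z)) (*-comm z w) ⟩
      (w * z) * (1ℚ /ℚ z)  ≡⟨ *-assoc w z _ ⟩
      w * (z * (1ℚ /ℚ z))  ≡⟨ cong (w *_) (*-1/ℚ z≢0) ⟩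
      w * 1ℚ               ≡⟨ *-identityʳ w ⟩
      w                    ∎

  ^-≢0 : ∀ {x} → x ≢ 0ℚ → ∀ n → x ^ℚ n ≢ 0ℚ
  ^-≢0 x≢0 zero    ()
  ^-≢0 {x} x≢0 (suc n) xxⁿ≡0 = ^-≢0 x≢0 n (*-cancelˡ x≢0 (trans xxⁿ≡0 (sym (*-zeroʳ x))))

  1/ℚ-^ : ∀ {x} → x ≢ 0ℚ → ∀ n → 1ℚ /ℚ (x ^ℚ n) ≡ (1ℚ /ℚ x) ^ℚ n
  1/ℚ-^ {x} x≢0 n = *-cancelˡ (^-≢0 x≢0 n) (begin
    x ^ℚ n * (1ℚ /ℚ (x ^ℚ n))  ≡⟨ *-1/ℚ (^-≢0 x≢0 n) ⟩
    1ℚ                          ≡⟨ ^-inverse (*-1/ℚ x≢0) n ⟨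
    x ^ℚ n * (1ℚ /ℚ x) ^ℚ n    ∎)

  x-1≢0 : ∀ {x} → x ≢ 1ℚ → x - 1ℚ ≢ 0ℚ
  x-1≢0 {x} x≢1 x-1≡0 = x≢1 (begin
    x                   ≡⟨ shift x ⟩
    (x - 1ℚ) + 1ℚ       ≡⟨ cong (_+ 1ℚ) x-1≡0 ⟩
    0ℚ + 1ℚ             ≡⟨⟩
    1ℚ                  ∎)
    where
    shift : ∀ x → x ≡ (x - 1ℚ) + 1ℚ
    shift = solve-∀ ℚ-ring

  1/ℚ-≢0 : ∀ {x} → x ≢ 0ℚ → 1ℚ /ℚ x ≢ 0ℚ
  1/ℚ-≢0 {x} x≢0 1/x≡0 = 1≢0 (begin
    1ℚ                ≡⟨ *-1/ℚ x≢0 ⟨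
    x * (1ℚ /ℚ x)     ≡⟨ cong (x *_) 1/x≡0 ⟩
    x * 0ℚ            ≡⟨ *-zeroʳ x ⟩
    0ℚ                ∎)

  *-/ℚ : ∀ {y} → y ≢ 0ℚ → ∀ x → y * (x /ℚ y) ≡ x
  *-/ℚ {y} y≢0 x = begin
    y * (x /ℚ y)          ≡⟨ cong (y *_) (/ℚ-≡-*-1/ℚ x y) ⟩
    y * (x * (1ℚ /ℚ y))   ≡⟨ swap y x (1ℚ /ℚ y) ⟩
    x * (y * (1ℚ /ℚ y))   ≡⟨ cong (x *_) (*-1/ℚ y≢0) ⟩
    x * 1ℚ                ≡⟨ *-identityʳ x ⟩
    x                     ∎
    where
    swap : ∀ a b c → a * (b * c) ≡ b * (a * c)
    swap = solve-∀ ℚ-ring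

  1/ℚ-≢1 : ∀ {x} → x ≢ 0ℚ → x ≢ 1ℚ → 1ℚ /ℚ x ≢ 1ℚ
  1/ℚ-≢1 {x} x≢0 x≢1 1/x≡1 = x≢1 (begin
    x                 ≡⟨ *-identityʳ x ⟨
    x * 1ℚ            ≡⟨ cong (x *_) 1/x≡1 ⟨
    x * (1ℚ /ℚ x)     ≡⟨ *-1/ℚ x≢0 ⟩
    1ℚ                ∎)

  1/[x-1]+1/[1/x-1] : ∀ {x} → x ≢ 0ℚ → x ≢ 1ℚ → 1ℚ /ℚ (x - 1ℚ) + 1ℚ /ℚ (1ℚ /ℚ x - 1ℚ) ≡ - 1ℚ
  1/[x-1]+1/[1/x-1] {x} x≢0 x≢1 = begin
    c + c′             ≡⟨ cong (c +_) c′≡-1-c ⟩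
    c + (- 1ℚ - c)     ≡⟨ cancel c ⟩
    - 1ℚ               ∎
    where
    p = 1ℚ /ℚ x
    c = 1ℚ /ℚ (x - 1ℚ)
    c′ = 1ℚ /ℚ (p - 1ℚ)
    cancel : ∀ c → c + (- 1ℚ - c) ≡ - 1ℚ
    cancel = solve-∀ ℚ-ring
    xc≡1+c : x * c ≡ 1ℚ + c
    xc≡1+c = begin
      x * c                    ≡⟨ split x c ⟩
      (x - 1ℚ) * c + c         ≡⟨ cong (_+ c) (*-1/ℚ (x-1≢0 x≢1)) ⟩
      1ℚ + c                   ∎
      where
      split : ∀ x c → x * c ≡ (x - 1ℚ) * c + c
      split = solve-∀ ℚ-ring
    p-1≢0 : p - 1ℚ ≢ 0ℚ
    p-1≢0 = x-1≢0 (1/ℚ-≢1 x≢0 x≢1)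
    c′≡-1-c : c′ ≡ - 1ℚ - c
    c′≡-1-c = *-cancelˡ p-1≢0 (begin
      (p - 1ℚ) * c′                  ≡⟨ *-1/ℚ p-1≢0 ⟩
      1ℚ                             ≡⟨ cancel′ c ⟨
      1ℚ + c - c                     ≡⟨ cong (λ t → 1ℚ + c - t) (trans (cong (_* c) (trans (*-comm p x) (*-1/ℚ x≢0))) (*-identityˡ c)) ⟨
      1ℚ + c - p * x * c             ≡⟨ cong (λ t → 1ℚ + c - t) (trans (*-assoc p x c) (cong (p *_) xc≡1+c)) ⟩
      1ℚ + c - p * (1ℚ + c)          ≡⟨ expand p c ⟩
      (p - 1ℚ) * (- 1ℚ - c)          ∎)
      where
      cancel′ : ∀ c → 1ℚ + c - c ≡ 1ℚ
      cancel′ = solve-∀ ℚ-ring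
      expand : ∀ p c → 1ℚ + c - p * (1ℚ + c) ≡ (p - 1ℚ) * (- 1ℚ - c)
      expand = solve-∀ ℚ-ring

module BigOperators where

  open import Data.Bool using (Bool; true; false)
  open import Data.Empty using (⊥-elim)
  open import Data.List using (List; []; _∷_; _++_; map; foldr; filter; length)
  open import Data.List.Membership.Propositional using (_∈_)
  open import Data.List.Relation.Unary.All using (lookup)
  open import Data.List.Relation.Unary.Any using (here; there)
  open import Data.List.Relation.Unary.Unique.Propositional using (Unique; _∷_)
  open import Data.Nat using (ℕ) renaming (_+_ to _+ℕ_)
  open import Data.Nat.Properties using (suc-injective)
  open import Data.Product using (_×_; _,_; proj₁; proj₂)
  open import Data.Rational using (ℚ; 0ℚ; 1ℚ; _+_; _*_; _-_)
  open import Data.Rational.Properties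
    using (+-identityˡ; +-identityʳ; +-assoc; *-identityˡ; *-zeroˡ; *-zeroʳ; *-comm; *-distribˡ-+)
  open import Level using (0ℓ)
  open import Relation.Binary.Definitions using (DecidableEquality)
  open import Relation.Binary.PropositionalEquality
  open import Relation.Nullary using (does)
  open import Relation.Nullary using (yes; no; ¬_)
  open import Relation.Nullary.Decidable using (dec-false)
  open import Relation.Unary using (Pred; Decidable)

  open import Defs using (sumℚ; _^ℚ_)
  open Rational

  open ≡-Reasoning

  ∑ : {A : Set} → List A → (A → ℚ) → ℚ
  ∑ xs f = sumℚ (map f xs)

  ∏ : {A : Set} → List A → (A → ℚ) → ℚ
  ∏ xs f = foldr _*_ 1ℚ (map f xs)

  syntax ∑ xs (λ x → e) = ∑[ x ∈ xs ] e
  syntax ∏ xs (λ x → e) = ∏[ x ∈ xs ] e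

  𝟙 : Bool → ℚ
  𝟙 true  = 1ℚ
  𝟙 false = 0ℚ

  module _ {A : Set} where

    ∑-cong : ∀ (xs : List A) {f g : A → ℚ} → (∀ {x} → x ∈ xs → f x ≡ g x) → ∑ xs f ≡ ∑ xs g
    ∑-cong []       f≗g = refl
    ∑-cong (x ∷ xs) f≗g = cong₂ _+_ (f≗g (here refl)) (∑-cong xs (λ x∈xs → f≗g (there x∈xs)))

    ∏-cong : ∀ (xs : List A) {f g : A → ℚ} → (∀ {x} → x ∈ xs → f x ≡ g x) → ∏ xs f ≡ ∏ xs g
    ∏-cong []       f≗g = refl
    ∏-cong (x ∷ xs) f≗g = cong₂ _*_ (f≗g (here refl)) (∏-cong xs (λ x∈xs → f≗g (there x∈xs)))

    ∑-++ : ∀ (xs ys : List A) f → ∑ (xs ++ ys) f ≡ ∑ xs f + ∑ ys f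
    ∑-++ []       ys f = sym (+-identityˡ _)
    ∑-++ (x ∷ xs) ys f = trans (cong (f x +_) (∑-++ xs ys f)) (sym (+-assoc (f x) _ _))

    ∑-+ : ∀ (xs : List A) f g → ∑[ x ∈ xs ] (f x + g x) ≡ ∑ xs f + ∑ xs g
    ∑-+ []       f g = refl
    ∑-+ (x ∷ xs) f g = trans (cong ((f x + g x) +_) (∑-+ xs f g)) (shuffle (f x) (g x) (∑ xs f) (∑ xs g))
      where
      shuffle : ∀ a b c d → (a + b) + (c + d) ≡ (a + c) + (b + d)
      shuffle = solve-∀ ℚ-ring

    ∑-*ˡ : ∀ c (xs : List A) f → c * ∑ xs f ≡ ∑[ x ∈ xs ] (c * f x)
    ∑-*ˡ c []       f = *-zeroʳ c
    ∑-*ˡ c (x ∷ xs) f = trans (*-distribˡ-+ c (f x) _) (cong (c * f x +_) (∑-*ˡ c xs f))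

    ∑-*ʳ : ∀ c (xs : List A) f → ∑ xs f * c ≡ ∑[ x ∈ xs ] (f x * c)
    ∑-*ʳ c xs f = trans (*-comm _ c) (trans (∑-*ˡ c xs f) (∑-cong xs (λ {x} _ → *-comm c (f x))))

    ∑-zero : ∀ (xs : List A) {f} → (∀ {x} → x ∈ xs → f x ≡ 0ℚ) → ∑ xs f ≡ 0ℚ
    ∑-zero []       f≡0 = refl
    ∑-zero (x ∷ xs) f≡0 = trans (cong₂ _+_ (f≡0 (here refl)) (∑-zero xs (λ x∈xs → f≡0 (there x∈xs)))) (+-identityˡ 0ℚ)

    ∑-filter : ∀ {P : Pred A 0ℓ} (P? : Decidable P) (xs : List A) f →
      ∑ (filter P? xs) f ≡ ∑[ x ∈ xs ] (𝟙 (does (P? x)) * f x)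
    ∑-filter P? []       f = refl
    ∑-filter P? (x ∷ xs) f with does (P? x)
    ... | true  = cong₂ _+_ (sym (*-identityˡ (f x))) (∑-filter P? xs f)
    ... | false = trans (∑-filter P? xs f) (sym (trans (cong (_+ _) (*-zeroˡ (f x))) (+-identityˡ _)))

    ∏-* : ∀ (xs : List A) f g → ∏ xs f * ∏ xs g ≡ ∏[ x ∈ xs ] (f x * g x)
    ∏-* []       f g = refl
    ∏-* (x ∷ xs) f g = trans (shuffle (f x) (∏ xs f) (g x) (∏ xs g)) (cong (f x * g x *_) (∏-* xs f g))
      where
      shuffle : ∀ a b c d → (a * b) * (c * d) ≡ (a * c) * (b * d)
      shuffle = solve-∀ ℚ-ring

    ∏-*-const : ∀ (xs : List A) f c → ∏[ x ∈ xs ] (f x * c) ≡ ∏ xs f * c ^ℚ length xs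
    ∏-*-const []       f c = refl
    ∏-*-const (x ∷ xs) f c = trans (cong (f x * c *_) (∏-*-const xs f c)) (shuffle (f x) c (∏ xs f) (c ^ℚ length xs))
      where
      shuffle : ∀ a b c d → (a * b) * (c * d) ≡ (a * c) * (b * d)
      shuffle = solve-∀ ℚ-ring

    ^-∑ : ∀ x (xs : List A) (g : A → ℕ) → x ^ℚ foldr _+ℕ_ 0 (map g xs) ≡ ∏[ y ∈ xs ] (x ^ℚ g y)
    ^-∑ x []       g = refl
    ^-∑ x (y ∷ xs) g = trans (^-+ x (g y) _) (cong (x ^ℚ g y *_) (^-∑ x xs g))

    ∑-- : ∀ (xs : List A) f g → ∑[ x ∈ xs ] (f x - g x) ≡ ∑ xs f - ∑ xs g
    ∑-- []       f g = refl
    ∑-- (x ∷ xs) f g = trans (cong ((f x - g x) +_) (∑-- xs f g)) (shuffle (f x) (g x) (∑ xs f) (∑ xs g))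
      where
      shuffle : ∀ a b c d → (a - b) + (c - d) ≡ (a + c) - (b + d)
      shuffle = solve-∀ ℚ-ring

    ∑-factor : ∀ (xs : List A) {f g} k → (∀ x → f x ≡ k * g x) → ∑ xs f ≡ k * ∑ xs g
    ∑-factor xs {f} {g} k f≡kg = trans (∑-cong xs (λ {x} _ → f≡kg x)) (sym (∑-*ˡ k xs g))

  module _ {A B : Set} where

    ∑-map : ∀ (h : A → B) (xs : List A) f → ∑ (map h xs) f ≡ ∑[ x ∈ xs ] f (h x)
    ∑-map h []       f = refl
    ∑-map h (x ∷ xs) f = cong (f (h x) +_) (∑-map h xs f)

    ∑-comm : ∀ (xs : List A) (ys : List B) (f : A → B → ℚ) →
      ∑[ x ∈ xs ] ∑[ y ∈ ys ] f x y ≡ ∑[ y ∈ ys ] ∑[ x ∈ xs ] f x y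
    ∑-comm []       ys f = sym (∑-zero ys (λ _ → refl))
    ∑-comm (x ∷ xs) ys f = trans (cong (∑ ys (f x) +_) (∑-comm xs ys f)) (sym (∑-+ ys (f x) _))

  module _ {A : Set} (_≟_ : DecidableEquality A) where

    ∑-pick : ∀ {xs : List A} {a} → Unique xs → a ∈ xs → ∀ (g : A → ℚ) → ∑[ x ∈ xs ] (𝟙 (does (a ≟ x)) * g x) ≡ g a
    ∑-pick {y ∷ ys} {a} (y∉ys ∷ ys!) a∈y∷ys g with a ≟ y | a∈y∷ys
    ... | yes refl | _ = begin
      1ℚ * g a + ∑[ x ∈ ys ] (𝟙 (does (a ≟ x)) * g x)  ≡⟨ cong₂ _+_ (*-identityˡ (g a)) (∑-zero ys a≢ys) ⟩
      g a + 0ℚ                                          ≡⟨ +-identityʳ (g a) ⟩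
      g a                                               ∎
      where
      a≢ys : ∀ {x} → x ∈ ys → 𝟙 (does (a ≟ x)) * g x ≡ 0ℚ
      a≢ys {x} x∈ys = trans (cong (λ b → 𝟙 b * g x) (dec-false (a ≟ x) (lookup y∉ys x∈ys))) (*-zeroˡ (g x))
    ... | no a≢y | here a≡y   = ⊥-elim (a≢y a≡y)
    ... | no _   | there a∈ys = begin
      0ℚ * g y + ∑[ x ∈ ys ] (𝟙 (does (a ≟ x)) * g x)  ≡⟨ cong (_+ ∑[ x ∈ ys ] (𝟙 (does (a ≟ x)) * g x)) (*-zeroˡ (g y)) ⟩
      0ℚ + ∑[ x ∈ ys ] (𝟙 (does (a ≟ x)) * g x)        ≡⟨ +-identityˡ _ ⟩
      ∑[ x ∈ ys ] (𝟙 (does (a ≟ x)) * g x)             ≡⟨ ∑-pick ys! a∈ys g ⟩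
      g a                                               ∎

  module _ {A : Set} {P : Pred A 0ℓ} (P? : Decidable P) (u v : A → ℚ) (v≡u : ∀ {j} → ¬ P j → v j ≡ u j) where

    private
      w : A → ℚ
      w j = u j - 𝟙 (does (P? j)) * v j

      ∏-none : ∀ js → length (filter P? js) ≡ 0 → ∏ js v ≡ ∏ js u × ∏ js w ≡ ∏ js u
      ∏-none []       _  = refl , refl
      ∏-none (j ∷ js) #0 with P? j
      ... | no ¬Pj = cong₂ _*_ (v≡u ¬Pj) v≡u′ , cong₂ _*_ (u-0*v (u j) (v j)) w≡u′
        where
        u-0*v : ∀ x y → x - 0ℚ * y ≡ x
        u-0*v = solve-∀ ℚ-ring
        v≡u′ = proj₁ (∏-none js #0)
        w≡u′ = proj₂ (∏-none js #0)

    ∏-difference : ∀ js → length (filter P? js) ≡ 1 → ∏ js u - ∏ js v ≡ ∏[ j ∈ js ] (u j - 𝟙 (does (P? j)) * v j)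
    ∏-difference (j ∷ js) #1 with P? j
    ... | yes _  = begin
      u j * ∏ js u - v j * ∏ js v   ≡⟨ cong (λ t → u j * ∏ js u - v j * t) (proj₁ (∏-none js (suc-injective #1))) ⟩
      u j * ∏ js u - v j * ∏ js u   ≡⟨ factorˡ (u j) (v j) (∏ js u) ⟩
      (u j - 1ℚ * v j) * ∏ js u     ≡⟨ cong ((u j - 1ℚ * v j) *_) (proj₂ (∏-none js (suc-injective #1))) ⟨
      (u j - 1ℚ * v j) * ∏ js w     ∎
      where
      factorˡ : ∀ x y z → x * z - y * z ≡ (x - 1ℚ * y) * z
      factorˡ = solve-∀ ℚ-ring
    ... | no ¬Pj = begin
      u j * ∏ js u - v j * ∏ js v   ≡⟨ cong (λ t → u j * ∏ js u - t * ∏ js v) (v≡u ¬Pj) ⟩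
      u j * ∏ js u - u j * ∏ js v   ≡⟨ factorʳ (u j) (v j) (∏ js u) (∏ js v) ⟩
      (u j - 0ℚ * v j) * (∏ js u - ∏ js v) ≡⟨ cong ((u j - 0ℚ * v j) *_) (∏-difference js #1) ⟩
      (u j - 0ℚ * v j) * ∏ js w     ∎
      where
      factorʳ : ∀ x y s t → x * s - x * t ≡ (x - 0ℚ * y) * (s - t)
      factorʳ = solve-∀ ℚ-ring

module Incidence where

  open import Data.Bool using (Bool; true; false; _∧_; _∨_; not)
  open import Data.Empty using (⊥-elim)
  open import Data.Fin using (Fin; zero; suc)
  open import Data.Fin.Subset using (Subset; ⊥; ⁅_⁆; _∈_; _∉_; _⊆_; _∪_; _∩_; ∁; ∣_∣)
  open import Data.Fin.Subset.Properties using (_⊆?_; _⊂?_; _∈?_; drop-∷-⊆; drop-there; ∪-identityʳ; ∪-assoc; ∪-comm; q⊆p∪q; x∈p∩q⁺; x∉p⇒x∈∁p)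
  open import Data.List using (List; []; _∷_; map; _++_; filter; length)
  open import Data.List.Membership.Propositional using () renaming (_∈_ to _∈ₗ_)
  import Data.List.Membership.Propositional.Properties as ∈ₗ
  open import Data.List.Properties using (filter-≐)
  open import Data.List.Relation.Unary.All using ([])
  open import Data.List.Relation.Unary.Any using (here)
  open import Data.List.Relation.Unary.Unique.Propositional using (Unique; _∷_; [])
  import Data.List.Relation.Unary.Unique.Propositional.Properties as Unique
  open import Data.Nat using (ℕ; zero; suc)
  open import Data.Product using (_×_; _,_)
  open import Data.Rational using (ℚ; 0ℚ; 1ℚ; _+_; _*_; _-_; -_)
  open import Data.Rational.Properties using (+-identityʳ; *-identityˡ; *-zeroˡ; *-zeroʳ; *-assoc; *-comm; *-distribʳ-+; *-distribˡ-+)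
  open import Data.Vec using ([]; _∷_; here; there; head; tail)
  import Data.Vec.Properties as Vec
  open import Function using (_∘_)
  open import Level using (0ℓ)
  open import Relation.Binary.Bundles using (Setoid)
  open import Relation.Binary.PropositionalEquality
  open import Relation.Nullary using (does; yes; no; ¬_)

  open import Defs using (allSubsets; _≟ₛ_; _^ℚ_)
  open Rational
  open BigOperators

  open ≡-Reasoning

  ∈-allSubsets : ∀ {n} (X : Subset n) → X ∈ₗ allSubsets n
  ∈-allSubsets []                = here refl
  ∈-allSubsets {suc n} (true ∷ X)  = ∈ₗ.∈-++⁺ˡ (∈ₗ.∈-map⁺ (true ∷_) (∈-allSubsets X))
  ∈-allSubsets {suc n} (false ∷ X) = ∈ₗ.∈-++⁺ʳ (map (true ∷_) (allSubsets n)) (∈ₗ.∈-map⁺ (false ∷_) (∈-allSubsets X))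

  allSubsets-unique : ∀ n → Unique (allSubsets n)
  allSubsets-unique zero    = [] ∷ []
  allSubsets-unique (suc n) = Unique.++⁺ (Unique.map⁺ Vec.∷-injectiveʳ (allSubsets-unique n))
                                         (Unique.map⁺ Vec.∷-injectiveʳ (allSubsets-unique n)) disjoint
    where
    disjoint : ∀ {X} → ¬ (X ∈ₗ map (true ∷_) (allSubsets n) × X ∈ₗ map (false ∷_) (allSubsets n))
    disjoint (X∈t , X∈f) with ∈ₗ.∈-map⁻ (true ∷_) X∈t | ∈ₗ.∈-map⁻ (false ∷_) X∈f
    ... | _ , _ , refl | _ , _ , ()

  ∑-allSubsets-suc : ∀ {n} (g : Subset (suc n) → ℚ) →
    ∑ (allSubsets (suc n)) g ≡ ∑[ X ∈ allSubsets n ] g (true ∷ X) + ∑[ X ∈ allSubsets n ] g (false ∷ X)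
  ∑-allSubsets-suc {n} g = begin
    ∑ (map (true ∷_) (allSubsets n) ++ map (false ∷_) (allSubsets n)) g
      ≡⟨ ∑-++ (map (true ∷_) (allSubsets n)) _ g ⟩
    ∑ (map (true ∷_) (allSubsets n)) g + ∑ (map (false ∷_) (allSubsets n)) g
      ≡⟨ cong₂ _+_ (∑-map (true ∷_) (allSubsets n) g) (∑-map (false ∷_) (allSubsets n) g) ⟩
    ∑[ X ∈ allSubsets n ] g (true ∷ X) + ∑[ X ∈ allSubsets n ] g (false ∷ X) ∎

  Kernel : ℕ → Set
  Kernel n = Subset n → Subset n → ℚ

  infix  4 _≈_
  infixl 7 _⋆_

  _≈_ : ∀ {n} → Kernel n → Kernel n → Set
  F ≈ G = ∀ A B → F A B ≡ G A B

  _⋆_ : ∀ {n} → Kernel n → Kernel n → Kernel n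
  _⋆_ {n} F G A B = ∑[ C ∈ allSubsets n ] (F A C * G C B)

  -- The Boolean lattice of subsets of Fin n is the n-th power of the chain false < true,
  -- and μ is the coordinatewise product of the Möbius function μ₂ of that chain.
  ζ₂ δ₂ μ₂ : Bool → Bool → ℚ
  ζ₂ true  false = 0ℚ
  ζ₂ _     _     = 1ℚ
  δ₂ true  true  = 1ℚ
  δ₂ false false = 1ℚ
  δ₂ _     _     = 0ℚ
  μ₂ true  false = 0ℚ
  μ₂ false true  = - 1ℚ
  μ₂ _     _     = 1ℚ

  ζ δ μ : ∀ {n} → Kernel n
  ζ A B = 𝟙 (does (A ⊆? B))
  δ A B = 𝟙 (does (A ≟ₛ B))
  μ []      []      = 1ℚ
  μ (a ∷ A) (b ∷ B) = μ₂ a b * μ A B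

  Factorises : (∀ {n} → Kernel n) → (Bool → Bool → ℚ) → Set
  Factorises F f = ∀ {n} a b (A B : Subset n) → F (a ∷ A) (b ∷ B) ≡ f a b * F A B

  ζ-factorises : Factorises ζ ζ₂
  ζ-factorises true  false A B = sym (*-zeroˡ (ζ A B))
  ζ-factorises true  true  A B = sym (*-identityˡ (ζ A B))
  ζ-factorises false false A B = sym (*-identityˡ (ζ A B))
  ζ-factorises false true  A B = sym (*-identityˡ (ζ A B))

  δ-factorises : Factorises δ δ₂
  δ-factorises true  false A B = sym (*-zeroˡ (δ A B))
  δ-factorises true  true  A B = sym (*-identityˡ (δ A B))
  δ-factorises false false A B = sym (*-identityˡ (δ A B))
  δ-factorises false true  A B = sym (*-zeroˡ (δ A B))

  μ-factorises : Factorises μ μ₂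
  μ-factorises a b A B = refl

  _⋆₂_ : (Bool → Bool → ℚ) → (Bool → Bool → ℚ) → Bool → Bool → ℚ
  (f ⋆₂ g) a b = f a true * g true b + f a false * g false b

  ⋆-factorises : ∀ {F G : ∀ {m} → Kernel m} {f g} → Factorises F f → Factorises G g → Factorises (F ⋆ G) (f ⋆₂ g)
  ⋆-factorises {F} {G} {f} {g} F≡ G≡ a b A B = begin
    ∑ (allSubsets _) (λ C → F (a ∷ A) C * G C (b ∷ B))
      ≡⟨ ∑-allSubsets-suc (λ C → F (a ∷ A) C * G C (b ∷ B)) ⟩
    ∑[ C ∈ allSubsets _ ] (F (a ∷ A) (true ∷ C) * G (true ∷ C) (b ∷ B))
      + ∑[ C ∈ allSubsets _ ] (F (a ∷ A) (false ∷ C) * G (false ∷ C) (b ∷ B))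
      ≡⟨ cong₂ _+_ (split true) (split false) ⟩
    f a true * g true b * (F ⋆ G) A B + f a false * g false b * (F ⋆ G) A B
      ≡⟨ *-distribʳ-+ ((F ⋆ G) A B) (f a true * g true b) (f a false * g false b) ⟨
    (f ⋆₂ g) a b * (F ⋆ G) A B ∎
    where
    shuffle : ∀ w x y z → (w * x) * (y * z) ≡ (w * y) * (x * z)
    shuffle = solve-∀ ℚ-ring
    split : ∀ c → ∑[ C ∈ allSubsets _ ] (F (a ∷ A) (c ∷ C) * G (c ∷ C) (b ∷ B)) ≡ f a c * g c b * (F ⋆ G) A B
    split c = begin
      ∑[ C ∈ allSubsets _ ] (F (a ∷ A) (c ∷ C) * G (c ∷ C) (b ∷ B))
        ≡⟨ ∑-cong (allSubsets _) (λ {C} _ → trans (cong₂ _*_ (F≡ a c A C) (G≡ c b C B)) (shuffle (f a c) (F A C) (g c b) (G C B))) ⟩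
      ∑[ C ∈ allSubsets _ ] (f a c * g c b * (F A C * G C B))
        ≡⟨ ∑-*ˡ (f a c * g c b) (allSubsets _) (λ C → F A C * G C B) ⟨
      f a c * g c b * (F ⋆ G) A B ∎

  ⋆-coordinatewise : ∀ {F G H : ∀ {m} → Kernel m} {f g h} → Factorises F f → Factorises G g → Factorises H h →
    (∀ a b → (f ⋆₂ g) a b ≡ h a b) → F {0} [] [] * G [] [] ≡ H [] [] → ∀ {n} → F ⋆ G ≈ H {n}
  ⋆-coordinatewise {F} {G} F≡ G≡ H≡ fg≡h base []      []      = trans (+-identityʳ (F [] [] * G [] [])) base
  ⋆-coordinatewise {F} {G} {H} {f} {g} {h} F≡ G≡ H≡ fg≡h base (a ∷ A) (b ∷ B) = begin
    (F ⋆ G) (a ∷ A) (b ∷ B)    ≡⟨ ⋆-factorises {F} {G} {f} {g} F≡ G≡ a b A B ⟩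
    (f ⋆₂ g) a b * (F ⋆ G) A B  ≡⟨ cong₂ _*_ (fg≡h a b) (⋆-coordinatewise {F} {G} {H} {f} {g} {h} F≡ G≡ H≡ fg≡h base A B) ⟩
    h a b * H A B               ≡⟨ H≡ a b A B ⟨
    H (a ∷ A) (b ∷ B)          ∎

  μ⋆ζ≈δ : ∀ {n} → μ ⋆ ζ ≈ δ {n}
  μ⋆ζ≈δ = ⋆-coordinatewise {μ} {ζ} {δ} {μ₂} {ζ₂} {δ₂} μ-factorises ζ-factorises δ-factorises μ₂⋆ζ₂ refl
    where
    μ₂⋆ζ₂ : ∀ a b → (μ₂ ⋆₂ ζ₂) a b ≡ δ₂ a b
    μ₂⋆ζ₂ true  true  = refl
    μ₂⋆ζ₂ true  false = refl
    μ₂⋆ζ₂ false true  = refl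
    μ₂⋆ζ₂ false false = refl

  ζ⋆μ≈δ : ∀ {n} → ζ ⋆ μ ≈ δ {n}
  ζ⋆μ≈δ = ⋆-coordinatewise {ζ} {μ} {δ} {ζ₂} {μ₂} {δ₂} ζ-factorises μ-factorises δ-factorises ζ₂⋆μ₂ refl
    where
    ζ₂⋆μ₂ : ∀ a b → (ζ₂ ⋆₂ μ₂) a b ≡ δ₂ a b
    ζ₂⋆μ₂ true  true  = refl
    ζ₂⋆μ₂ true  false = refl
    ζ₂⋆μ₂ false true  = refl
    ζ₂⋆μ₂ false false = refl

  infixl 6 _⊕_ _⊖_
  infixr 7 _·_

  _⊕_ _⊖_ : ∀ {n} → Kernel n → Kernel n → Kernel n
  (F ⊕ G) A B = F A B + G A B
  (F ⊖ G) A B = F A B - G A B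

  _·_ : ∀ {n} → ℚ → Kernel n → Kernel n
  (c · F) A B = c * F A B

  module _ {n : ℕ} where

    ≈-setoid : Setoid 0ℓ 0ℓ
    ≈-setoid = record
      { Carrier       = Kernel n
      ; _≈_           = _≈_
      ; isEquivalence = record
        { refl  = λ _ _ → refl
        ; sym   = λ F≈G A B → sym (F≈G A B)
        ; trans = λ F≈G G≈H A B → trans (F≈G A B) (G≈H A B)
        }
      }

    private
      Ω : List (Subset n)
      Ω = allSubsets n

    ⋆-cong : ∀ {F F′ G G′ : Kernel n} → F ≈ F′ → G ≈ G′ → F ⋆ G ≈ F′ ⋆ G′
    ⋆-cong F≈F′ G≈G′ A B = ∑-cong Ω (λ {C} _ → cong₂ _*_ (F≈F′ A C) (G≈G′ C B))

    ⋆-congˡ : ∀ (F : Kernel n) {G G′} → G ≈ G′ → F ⋆ G ≈ F ⋆ G′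
    ⋆-congˡ F = ⋆-cong {F} {F} (λ _ _ → refl)

    ⋆-congʳ : ∀ (G : Kernel n) {F F′} → F ≈ F′ → F ⋆ G ≈ F′ ⋆ G
    ⋆-congʳ G F≈F′ = ⋆-cong {G = G} {G′ = G} F≈F′ (λ _ _ → refl)

    ⋆-assoc : ∀ (F G H : Kernel n) → (F ⋆ G) ⋆ H ≈ F ⋆ (G ⋆ H)
    ⋆-assoc F G H A B = begin
      ∑[ D ∈ Ω ] (∑[ C ∈ Ω ] (F A C * G C D) * H D B)   ≡⟨ ∑-cong Ω (λ {D} _ → ∑-*ʳ (H D B) Ω (λ C → F A C * G C D)) ⟩
      ∑[ D ∈ Ω ] ∑[ C ∈ Ω ] (F A C * G C D * H D B)     ≡⟨ ∑-comm Ω Ω (λ D C → F A C * G C D * H D B) ⟩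
      ∑[ C ∈ Ω ] ∑[ D ∈ Ω ] (F A C * G C D * H D B)     ≡⟨ ∑-cong Ω (λ {C} _ → ∑-cong Ω (λ {D} _ → *-assoc (F A C) (G C D) (H D B))) ⟩
      ∑[ C ∈ Ω ] ∑[ D ∈ Ω ] (F A C * (G C D * H D B))   ≡⟨ ∑-cong Ω (λ {C} _ → ∑-*ˡ (F A C) Ω (λ D → G C D * H D B)) ⟨
      ∑[ C ∈ Ω ] (F A C * ∑[ D ∈ Ω ] (G C D * H D B))   ∎

    δ-sym : ∀ (A B : Subset n) → δ A B ≡ δ B A
    δ-sym A B with A ≟ₛ B | B ≟ₛ A
    ... | yes _   | yes _   = refl
    ... | no  _   | no  _   = refl
    ... | yes A≡B | no  B≢A = ⊥-elim (B≢A (sym A≡B))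
    ... | no  A≢B | yes B≡A = ⊥-elim (A≢B (sym B≡A))

    δ-⋆ : ∀ (F : Kernel n) → δ ⋆ F ≈ F
    δ-⋆ F A B = ∑-pick _≟ₛ_ (allSubsets-unique n) (∈-allSubsets A) (λ C → F C B)

    ⋆-δ : ∀ (F : Kernel n) → F ⋆ δ ≈ F
    ⋆-δ F A B = trans (∑-cong Ω (λ {C} _ → trans (*-comm (F A C) (δ C B)) (cong (_* F A C) (δ-sym C B))))
                      (∑-pick _≟ₛ_ (allSubsets-unique n) (∈-allSubsets B) (F A))

    ⊕-⋆ : ∀ (F G H : Kernel n) → (F ⊕ G) ⋆ H ≈ F ⋆ H ⊕ G ⋆ H
    ⊕-⋆ F G H A B = trans (∑-cong Ω (λ {C} _ → *-distribʳ-+ (H C B) (F A C) (G A C))) (∑-+ Ω _ _)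

    ⋆-⊕ : ∀ (F G H : Kernel n) → F ⋆ (G ⊕ H) ≈ F ⋆ G ⊕ F ⋆ H
    ⋆-⊕ F G H A B = trans (∑-cong Ω (λ {C} _ → *-distribˡ-+ (F A C) (G C B) (H C B))) (∑-+ Ω _ _)

    ⊖-⋆ : ∀ (F G H : Kernel n) → (F ⊖ G) ⋆ H ≈ F ⋆ H ⊖ G ⋆ H
    ⊖-⋆ F G H A B = trans (∑-cong Ω (λ {C} _ → distrib (F A C) (G A C) (H C B))) (∑-- Ω _ _)
      where
      distrib : ∀ f g h → (f - g) * h ≡ f * h - g * h
      distrib = solve-∀ ℚ-ring

    ⋆-⊖ : ∀ (F G H : Kernel n) → F ⋆ (G ⊖ H) ≈ F ⋆ G ⊖ F ⋆ H
    ⋆-⊖ F G H A B = trans (∑-cong Ω (λ {C} _ → distrib (F A C) (G C B) (H C B))) (∑-- Ω _ _)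
      where
      distrib : ∀ f g h → f * (g - h) ≡ f * g - f * h
      distrib = solve-∀ ℚ-ring

    ·-⋆ : ∀ c (F G : Kernel n) → (c · F) ⋆ G ≈ c · (F ⋆ G)
    ·-⋆ c F G A B = trans (∑-cong Ω (λ {C} _ → *-assoc c (F A C) (G C B))) (sym (∑-*ˡ c Ω _))


  μ-⊥ : ∀ {n} (X : Subset n) → μ ⊥ X ≡ (- 1ℚ) ^ℚ ∣ X ∣
  μ-⊥ []          = refl
  μ-⊥ (true ∷ X)  = cong (- 1ℚ *_) (μ-⊥ X)
  μ-⊥ (false ∷ X) = trans (*-identityˡ (μ ⊥ X)) (μ-⊥ X)

  δ-* : ∀ {n} (A B : Subset n) (h : Subset n → ℚ) → δ A B * h B ≡ δ A B * h A
  δ-* A B h with A ≟ₛ B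
  ... | yes refl = refl
  ... | no  _    = trans (*-zeroˡ (h B)) (sym (*-zeroˡ (h A)))

  ⊂-+-δ : ∀ {n} (A B : Subset n) → 𝟙 (does (A ⊂? B)) + δ A B ≡ ζ A B
  ⊂-+-δ []          []          = refl
  ⊂-+-δ (false ∷ A) (false ∷ B) = trans (cong (𝟙 (does (A ⊂? B)) +_) (trans (δ-factorises false false A B) (*-identityˡ (δ A B)))) (⊂-+-δ A B)
  ⊂-+-δ (false ∷ A) (true ∷ B)  = trans (cong (𝟙 (does (A ⊆? B)) +_) (trans (δ-factorises false true A B) (*-zeroˡ (δ A B)))) (+-identityʳ _)
  ⊂-+-δ (true ∷ A)  (false ∷ B) = cong (0ℚ +_) (trans (δ-factorises true false A B) (*-zeroˡ (δ A B)))
  ⊂-+-δ (true ∷ A)  (true ∷ B)  = trans (cong (𝟙 (does (A ⊂? B)) +_) (trans (δ-factorises true true A B) (*-identityˡ (δ A B)))) (⊂-+-δ A B)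

  private
    interchange : ∀ w x y z → (w * x) * (y * z) ≡ (w * y) * (x * z)
    interchange = solve-∀ ℚ-ring

  μζ-support : ∀ {n} (A U B : Subset n) → μ A U * ζ U B ≡ ζ A B * (μ A U * ζ U B)
  μζ-support []      []      []      = refl
  μζ-support (a ∷ A) (u ∷ U) (b ∷ B) = begin
    μ₂ a u * μ A U * ζ (u ∷ U) (b ∷ B)                      ≡⟨ cong (μ₂ a u * μ A U *_) (ζ-factorises u b U B) ⟩
    μ₂ a u * μ A U * (ζ₂ u b * ζ U B)                        ≡⟨ interchange (μ₂ a u) (μ A U) (ζ₂ u b) (ζ U B) ⟩
    μ₂ a u * ζ₂ u b * (μ A U * ζ U B)                        ≡⟨ cong₂ _*_ (coordinate a u b) (μζ-support A U B) ⟩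
    ζ₂ a b * (μ₂ a u * ζ₂ u b) * (ζ A B * (μ A U * ζ U B))   ≡⟨ interchange (ζ₂ a b) _ (ζ A B) _ ⟩
    ζ₂ a b * ζ A B * (μ₂ a u * ζ₂ u b * (μ A U * ζ U B))     ≡⟨ cong₂ _*_ (ζ-factorises a b A B) (interchange (μ₂ a u) (μ A U) (ζ₂ u b) (ζ U B)) ⟨
    ζ (a ∷ A) (b ∷ B) * (μ₂ a u * μ A U * (ζ₂ u b * ζ U B))  ≡⟨ cong (λ z → ζ (a ∷ A) (b ∷ B) * (μ₂ a u * μ A U * z)) (ζ-factorises u b U B) ⟨
    ζ (a ∷ A) (b ∷ B) * (μ₂ a u * μ A U * ζ (u ∷ U) (b ∷ B)) ∎
    where
    coordinate : ∀ a u b → μ₂ a u * ζ₂ u b ≡ ζ₂ a b * (μ₂ a u * ζ₂ u b)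
    coordinate false false false = refl
    coordinate false false true  = refl
    coordinate false true  false = refl
    coordinate false true  true  = refl
    coordinate true  false false = refl
    coordinate true  false true  = refl
    coordinate true  true  false = refl
    coordinate true  true  true  = refl

  μζ-diagonal : ∀ {n} (A U : Subset n) → μ A U * ζ U A ≡ δ A U
  μζ-diagonal []      []      = refl
  μζ-diagonal (a ∷ A) (u ∷ U) = begin
    μ₂ a u * μ A U * ζ (u ∷ U) (a ∷ A)  ≡⟨ cong (μ₂ a u * μ A U *_) (ζ-factorises u a U A) ⟩
    μ₂ a u * μ A U * (ζ₂ u a * ζ U A)   ≡⟨ interchange (μ₂ a u) (μ A U) (ζ₂ u a) (ζ U A) ⟩
    μ₂ a u * ζ₂ u a * (μ A U * ζ U A)   ≡⟨ cong₂ _*_ (coordinate a u) (μζ-diagonal A U) ⟩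
    δ₂ a u * δ A U                      ≡⟨ δ-factorises a u A U ⟨
    δ (a ∷ A) (u ∷ U)                   ∎
    where
    coordinate : ∀ a u → μ₂ a u * ζ₂ u a ≡ δ₂ a u
    coordinate false false = refl
    coordinate false true  = refl
    coordinate true  false = refl
    coordinate true  true  = refl

  ∑-shift : ∀ {n} (a b : Subset n) (g : Subset n → ℚ) → a ⊆ b →
    ∑[ X ∈ allSubsets n ] (μ ⊥ X * (ζ X (b ∩ ∁ a) * g (X ∪ a))) ≡ ∑[ U ∈ allSubsets n ] (μ a U * (ζ U b * g U))
  ∑-shift []      []      g a⊆b = refl
  ∑-shift {suc n} (x ∷ a) (y ∷ b) g x∷a⊆y∷b = begin
    ∑ (allSubsets (suc n)) (λ X → μ ⊥ X * (ζ X ((y ∷ b) ∩ ∁ (x ∷ a)) * g (X ∪ (x ∷ a))))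
      ≡⟨ ∑-allSubsets-suc (λ X → μ ⊥ X * (ζ X ((y ∷ b) ∩ ∁ (x ∷ a)) * g (X ∪ (x ∷ a)))) ⟩
    shifted true + shifted false
      ≡⟨ cong₂ _+_ (shifted≡ true) (shifted≡ false) ⟩
    μ₂ false true * ζ₂ true (y ∧ not x) * R (true ∨ x) + μ₂ false false * ζ₂ false (y ∧ not x) * R (false ∨ x)
      ≡⟨ coordinate x y x∷a⊆y∷b ⟩
    μ₂ x true * ζ₂ true y * R true + μ₂ x false * ζ₂ false y * R false
      ≡⟨ cong₂ _+_ (unshifted≡ true) (unshifted≡ false) ⟨
    unshifted true + unshifted false
      ≡⟨ ∑-allSubsets-suc (λ U → μ (x ∷ a) U * (ζ U (y ∷ b) * g U)) ⟨
    ∑ (allSubsets (suc n)) (λ U → μ (x ∷ a) U * (ζ U (y ∷ b) * g U)) ∎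
    where
    R : Bool → ℚ
    R d = ∑[ U ∈ allSubsets n ] (μ a U * (ζ U b * g (d ∷ U)))
    shifted unshifted : Bool → ℚ
    shifted c = ∑[ X ∈ allSubsets n ] (μ ⊥ (c ∷ X) * (ζ (c ∷ X) ((y ∧ not x) ∷ (b ∩ ∁ a)) * g ((c ∨ x) ∷ (X ∪ a))))
    unshifted c = ∑[ U ∈ allSubsets n ] (μ (x ∷ a) (c ∷ U) * (ζ (c ∷ U) (y ∷ b) * g (c ∷ U)))
    regroup : ∀ v w x y z → (v * w) * ((x * y) * z) ≡ (v * x) * (w * (y * z))
    regroup = solve-∀ ℚ-ring
    shifted≡ : ∀ c → shifted c ≡ μ₂ false c * ζ₂ c (y ∧ not x) * R (c ∨ x)
    shifted≡ c = begin
      shifted c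
        ≡⟨ ∑-factor (allSubsets n) (μ₂ false c * ζ₂ c (y ∧ not x)) (λ X →
             trans (cong (λ z → μ₂ false c * μ ⊥ X * (z * g ((c ∨ x) ∷ (X ∪ a)))) (ζ-factorises c (y ∧ not x) X (b ∩ ∁ a)))
                   (regroup (μ₂ false c) (μ ⊥ X) (ζ₂ c (y ∧ not x)) (ζ X (b ∩ ∁ a)) (g ((c ∨ x) ∷ (X ∪ a))))) ⟩
      μ₂ false c * ζ₂ c (y ∧ not x) * ∑[ X ∈ allSubsets n ] (μ ⊥ X * (ζ X (b ∩ ∁ a) * g ((c ∨ x) ∷ (X ∪ a))))
        ≡⟨ cong (μ₂ false c * ζ₂ c (y ∧ not x) *_) (∑-shift a b (λ U → g ((c ∨ x) ∷ U)) (drop-∷-⊆ x∷a⊆y∷b)) ⟩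
      μ₂ false c * ζ₂ c (y ∧ not x) * R (c ∨ x) ∎
    unshifted≡ : ∀ c → unshifted c ≡ μ₂ x c * ζ₂ c y * R c
    unshifted≡ c = ∑-factor (allSubsets n) (μ₂ x c * ζ₂ c y) (λ U →
      trans (cong (λ z → μ₂ x c * μ a U * (z * g (c ∷ U))) (ζ-factorises c y U b))
            (regroup (μ₂ x c) (μ a U) (ζ₂ c y) (ζ U b) (g (c ∷ U))))
    coordinate : ∀ x y → x ∷ a ⊆ y ∷ b →
      μ₂ false true * ζ₂ true (y ∧ not x) * R (true ∨ x) + μ₂ false false * ζ₂ false (y ∧ not x) * R (false ∨ x)
        ≡ μ₂ x true * ζ₂ true y * R true + μ₂ x false * ζ₂ false y * R false
    coordinate false false _   = refl
    coordinate false true  _   = refl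
    coordinate true  true  _   = eliminate (R true) (R false)
      where
      eliminate : ∀ t f → - 1ℚ * 0ℚ * t + 1ℚ * 1ℚ * t ≡ 1ℚ * 1ℚ * t + 0ℚ * 1ℚ * f
      eliminate = solve-∀ ℚ-ring
    coordinate true  false x⊆y with () ← x⊆y here

  ∑-μ⊥-toggle : ∀ {n} (B : Subset n) (e : Fin n) (g : Subset n → ℚ) → e ∈ B → (∀ X → g (X ∪ ⁅ e ⁆) ≡ g X) →
    ∑[ X ∈ allSubsets n ] (μ ⊥ X * (ζ X B * g X)) ≡ 0ℚ
  ∑-μ⊥-toggle {suc n} (true ∷ B) zero g here g-toggle = begin
    ∑ (allSubsets (suc n)) (λ X → μ ⊥ X * (ζ X (true ∷ B) * g X))
      ≡⟨ ∑-allSubsets-suc (λ X → μ ⊥ X * (ζ X (true ∷ B) * g X)) ⟩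
    ∑[ X ∈ allSubsets n ] (- 1ℚ * μ ⊥ X * (ζ X B * g (true ∷ X))) + ∑[ X ∈ allSubsets n ] (1ℚ * μ ⊥ X * (ζ X B * g (false ∷ X)))
      ≡⟨ ∑-+ (allSubsets n) _ _ ⟨
    ∑[ X ∈ allSubsets n ] (- 1ℚ * μ ⊥ X * (ζ X B * g (true ∷ X)) + 1ℚ * μ ⊥ X * (ζ X B * g (false ∷ X)))
      ≡⟨ ∑-zero (allSubsets n) (λ {X} _ → cancel (μ ⊥ X) (ζ X B) (toggled X)) ⟩
    0ℚ ∎
    where
    toggled : ∀ X → g (true ∷ X) ≡ g (false ∷ X)
    toggled X = trans (cong (λ Y → g (true ∷ Y)) (sym (∪-identityʳ X))) (g-toggle (false ∷ X))
    cancel : ∀ m z {t f} → t ≡ f → - 1ℚ * m * (z * t) + 1ℚ * m * (z * f) ≡ 0ℚ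
    cancel m z {t} refl = cancellation m z t
      where
      cancellation : ∀ m z t → - 1ℚ * m * (z * t) + 1ℚ * m * (z * t) ≡ 0ℚ
      cancellation = solve-∀ ℚ-ring
  ∑-μ⊥-toggle {suc n} (b ∷ B) (suc e) g (there e∈B) g-toggle = begin
    ∑ (allSubsets (suc n)) (λ X → μ ⊥ X * (ζ X (b ∷ B) * g X))
      ≡⟨ ∑-allSubsets-suc (λ X → μ ⊥ X * (ζ X (b ∷ B) * g X)) ⟩
    slice true + slice false
      ≡⟨ cong₂ _+_ (slice≡0 true) (slice≡0 false) ⟩
    0ℚ + 0ℚ
      ≡⟨ +-identityʳ 0ℚ ⟩
    0ℚ ∎
    where
    slice : Bool → ℚ
    slice c = ∑[ X ∈ allSubsets n ] (μ ⊥ (c ∷ X) * (ζ (c ∷ X) (b ∷ B) * g (c ∷ X)))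
    regroup : ∀ v w x y z → (v * w) * ((x * y) * z) ≡ (v * x) * (w * (y * z))
    regroup = solve-∀ ℚ-ring
    toggle-tail : ∀ c X → g (c ∷ (X ∪ ⁅ e ⁆)) ≡ g (c ∷ X)
    toggle-tail true  X = g-toggle (true ∷ X)
    toggle-tail false X = g-toggle (false ∷ X)
    slice≡0 : ∀ c → slice c ≡ 0ℚ
    slice≡0 c = begin
      slice c
        ≡⟨ ∑-factor (allSubsets n) (μ₂ false c * ζ₂ c b) (λ X →
             trans (cong (λ z → μ₂ false c * μ ⊥ X * (z * g (c ∷ X))) (ζ-factorises c b X B))
                   (regroup (μ₂ false c) (μ ⊥ X) (ζ₂ c b) (ζ X B) (g (c ∷ X)))) ⟩
      μ₂ false c * ζ₂ c b * ∑[ X ∈ allSubsets n ] (μ ⊥ X * (ζ X B * g (c ∷ X)))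
        ≡⟨ cong (μ₂ false c * ζ₂ c b *_) (∑-μ⊥-toggle B e (λ X → g (c ∷ X)) e∈B (toggle-tail c)) ⟩
      μ₂ false c * ζ₂ c b * 0ℚ
        ≡⟨ *-zeroʳ (μ₂ false c * ζ₂ c b) ⟩
      0ℚ ∎

  ∑-μ⊥ζ-∷ : ∀ {n} (C : Subset (suc n)) (k : Subset (suc n) → ℚ) →
    ∑[ X ∈ allSubsets (suc n) ] (μ ⊥ X * (ζ X C * k X))
      ≡ ∑[ X ∈ allSubsets n ] (μ ⊥ X * (ζ X (tail C) * k ((false ∧ head C) ∷ X)))
        - 𝟙 (does (zero ∈? C)) * ∑[ X ∈ allSubsets n ] (μ ⊥ X * (ζ X (tail C) * k ((true ∧ head C) ∷ X)))
  ∑-μ⊥ζ-∷ {n} (true ∷ C) k = begin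
    ∑ (allSubsets (suc n)) (λ X → μ ⊥ X * (ζ X (true ∷ C) * k X))
      ≡⟨ ∑-allSubsets-suc (λ X → μ ⊥ X * (ζ X (true ∷ C) * k X)) ⟩
    ∑[ X ∈ allSubsets n ] (- 1ℚ * μ ⊥ X * (ζ X C * k (true ∷ X))) + ∑[ X ∈ allSubsets n ] (1ℚ * μ ⊥ X * (ζ X C * k (false ∷ X)))
      ≡⟨ cong₂ _+_ (∑-factor (allSubsets n) (- 1ℚ) (λ X → *-assoc (- 1ℚ) (μ ⊥ X) _))
                   (∑-factor (allSubsets n) 1ℚ (λ X → *-assoc 1ℚ (μ ⊥ X) _)) ⟩
    - 1ℚ * S (true ∷_) + 1ℚ * S (false ∷_)
      ≡⟨ rearrange (S (true ∷_)) (S (false ∷_)) ⟩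
    S (false ∷_) - 1ℚ * S (true ∷_) ∎
    where
    S : (Subset n → Subset (suc n)) → ℚ
    S ι = ∑[ X ∈ allSubsets n ] (μ ⊥ X * (ζ X C * k (ι X)))
    rearrange : ∀ s t → - 1ℚ * s + 1ℚ * t ≡ t - 1ℚ * s
    rearrange = solve-∀ ℚ-ring
  ∑-μ⊥ζ-∷ {n} (false ∷ C) k = begin
    ∑ (allSubsets (suc n)) (λ X → μ ⊥ X * (ζ X (false ∷ C) * k X))
      ≡⟨ ∑-allSubsets-suc (λ X → μ ⊥ X * (ζ X (false ∷ C) * k X)) ⟩
    ∑[ X ∈ allSubsets n ] (- 1ℚ * μ ⊥ X * (0ℚ * k (true ∷ X))) + ∑[ X ∈ allSubsets n ] (1ℚ * μ ⊥ X * (ζ X C * k (false ∷ X)))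
      ≡⟨ cong₂ _+_ (∑-factor (allSubsets n) 0ℚ (λ X → vanishing (μ ⊥ X) (k (true ∷ X)) (ζ X C * k (false ∷ X))))
                   (∑-factor (allSubsets n) 1ℚ (λ X → *-assoc 1ℚ (μ ⊥ X) _)) ⟩
    0ℚ * S + 1ℚ * S
      ≡⟨ rearrange S ⟩
    S - 0ℚ * S ∎
    where
    S : ℚ
    S = ∑[ X ∈ allSubsets n ] (μ ⊥ X * (ζ X C * k (false ∷ X)))
    vanishing : ∀ m t u → - 1ℚ * m * (0ℚ * t) ≡ 0ℚ * (m * u)
    vanishing = solve-∀ ℚ-ring
    rearrange : ∀ s → 0ℚ * s + 1ℚ * s ≡ s - 0ℚ * s
    rearrange = solve-∀ ℚ-ring

  ∑-μζ-toggle : ∀ {n} {A B : Subset n} {e} (g : Subset n → ℚ) → A ⊆ B → e ∉ A → e ∈ B →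
    (∀ U → A ⊆ U → g (U ∪ ⁅ e ⁆) ≡ g U) → ∑[ U ∈ allSubsets n ] (μ A U * (ζ U B * g U)) ≡ 0ℚ
  ∑-μζ-toggle {n} {A} {B} {e} g A⊆B e∉A e∈B g-toggle = begin
    ∑[ U ∈ allSubsets n ] (μ A U * (ζ U B * g U))                  ≡⟨ ∑-shift A B g A⊆B ⟨
    ∑[ X ∈ allSubsets n ] (μ ⊥ X * (ζ X (B ∩ ∁ A) * g (X ∪ A)))    ≡⟨ ∑-μ⊥-toggle (B ∩ ∁ A) e (λ X → g (X ∪ A)) e∈B∖A toggle ⟩
    0ℚ                                                              ∎
    where
    e∈B∖A : e ∈ B ∩ ∁ A
    e∈B∖A = x∈p∩q⁺ (e∈B , x∉p⇒x∈∁p e∉A)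
    toggle : ∀ X → g ((X ∪ ⁅ e ⁆) ∪ A) ≡ g (X ∪ A)
    toggle X = begin
      g ((X ∪ ⁅ e ⁆) ∪ A)   ≡⟨ cong g (∪-assoc X ⁅ e ⁆ A) ⟩
      g (X ∪ (⁅ e ⁆ ∪ A))   ≡⟨ cong (λ Y → g (X ∪ Y)) (∪-comm ⁅ e ⁆ A) ⟩
      g (X ∪ (A ∪ ⁅ e ⁆))   ≡⟨ cong g (∪-assoc X A ⁅ e ⁆) ⟨
      g ((X ∪ A) ∪ ⁅ e ⁆)   ≡⟨ g-toggle (X ∪ A) (q⊆p∪q X A) ⟩
      g (X ∪ A)             ∎

  ∑-μ⊥-∏ : ∀ {n} {J : Set} (js : List J) (B : J → Subset n) (h : J → Subset n → ℚ) →
    (∀ e → length (filter (λ j → e ∈? B j) js) ≡ 1) →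
    ∑[ X ∈ allSubsets n ] (μ ⊥ X * ∏[ j ∈ js ] h j (X ∩ B j))
      ≡ ∏[ j ∈ js ] ∑[ X ∈ allSubsets n ] (μ ⊥ X * (ζ X (B j) * h j X))
  ∑-μ⊥-∏ {zero} js B h _ = begin
    1ℚ * ∏[ j ∈ js ] h j ([] ∩ B j) + 0ℚ  ≡⟨ trans (+-identityʳ _) (*-identityˡ _) ⟩
    ∏[ j ∈ js ] h j ([] ∩ B j)            ≡⟨ ∏-cong js (λ {j} _ → singleton j) ⟩
    ∏[ j ∈ js ] (1ℚ * (ζ [] (B j) * h j []) + 0ℚ) ∎
    where
    singleton : ∀ j → h j ([] ∩ B j) ≡ 1ℚ * (ζ [] (B j) * h j []) + 0ℚ
    singleton j with B j
    ... | [] = sym (trans (+-identityʳ _) (trans (*-identityˡ _) (*-identityˡ _)))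
  ∑-μ⊥-∏ {suc n} {J} js B h once = begin
    ∑ (allSubsets (suc n)) (λ X → μ ⊥ X * ∏[ j ∈ js ] h j (X ∩ B j))
      ≡⟨ ∑-allSubsets-suc (λ X → μ ⊥ X * ∏[ j ∈ js ] h j (X ∩ B j)) ⟩
    ∑[ X ∈ allSubsets n ] (- 1ℚ * μ ⊥ X * ∏[ j ∈ js ] h j ((true ∷ X) ∩ B j))
      + ∑[ X ∈ allSubsets n ] (1ℚ * μ ⊥ X * ∏[ j ∈ js ] h j ((false ∷ X) ∩ B j))
      ≡⟨ cong₂ _+_ (∑-factor (allSubsets n) (- 1ℚ) (slice true)) (∑-factor (allSubsets n) 1ℚ (slice false)) ⟩
    - 1ℚ * ∑[ X ∈ allSubsets n ] (μ ⊥ X * ∏[ j ∈ js ] h′ true j (X ∩ tail (B j)))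
      + 1ℚ * ∑[ X ∈ allSubsets n ] (μ ⊥ X * ∏[ j ∈ js ] h′ false j (X ∩ tail (B j)))
      ≡⟨ cong₂ (λ s t → - 1ℚ * s + 1ℚ * t) (∑-μ⊥-∏ js (tail ∘ B) (h′ true) once′) (∑-μ⊥-∏ js (tail ∘ B) (h′ false) once′) ⟩
    - 1ℚ * ∏ js (V true) + 1ℚ * ∏ js (V false)
      ≡⟨ difference (∏ js (V true)) (∏ js (V false)) ⟩
    ∏ js (V false) - ∏ js (V true)
      ≡⟨ ∏-difference (λ j → zero ∈? B j) (V false) (V true) V-outside js (once zero) ⟩
    ∏[ j ∈ js ] (V false j - 𝟙 (does (zero ∈? B j)) * V true j)
      ≡⟨ ∏-cong js (λ {j} _ → ∑-μ⊥ζ-∷ (B j) (h j)) ⟨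
    ∏[ j ∈ js ] ∑[ X ∈ allSubsets (suc n) ] (μ ⊥ X * (ζ X (B j) * h j X)) ∎
    where
    h′ : Bool → J → Subset n → ℚ
    h′ c j Y = h j ((c ∧ head (B j)) ∷ Y)
    V : Bool → J → ℚ
    V c j = ∑[ X ∈ allSubsets n ] (μ ⊥ X * (ζ X (tail (B j)) * h′ c j X))
    ∩-∷ : ∀ c X (C : Subset (suc n)) → (c ∷ X) ∩ C ≡ (c ∧ head C) ∷ (X ∩ tail C)
    ∩-∷ c X (b ∷ C) = refl
    slice : ∀ c X → μ₂ false c * μ ⊥ X * ∏[ j ∈ js ] h j ((c ∷ X) ∩ B j)
                    ≡ μ₂ false c * (μ ⊥ X * ∏[ j ∈ js ] h′ c j (X ∩ tail (B j)))
    slice c X = trans (cong (μ₂ false c * μ ⊥ X *_) (∏-cong js (λ {j} _ → cong (h j) (∩-∷ c X (B j)))))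
                      (*-assoc (μ₂ false c) (μ ⊥ X) _)
    once′ : ∀ e → length (filter (λ j → e ∈? tail (B j)) js) ≡ 1
    once′ e = trans (cong length (filter-≐ (λ j → e ∈? tail (B j)) (λ j → suc e ∈? B j) (∈-tail⁺ _ , ∈-tail⁻ _) js)) (once (suc e))
      where
      ∈-tail⁺ : ∀ (C : Subset (suc n)) → e ∈ tail C → suc e ∈ C
      ∈-tail⁺ (b ∷ C) = there
      ∈-tail⁻ : ∀ (C : Subset (suc n)) → suc e ∈ C → e ∈ tail C
      ∈-tail⁻ (b ∷ C) = drop-there
    V-outside : ∀ {j} → zero ∉ B j → V true j ≡ V false j
    V-outside {j} 0∉Bj with B j
    ... | false ∷ C = refl
    ... | true ∷ C  = ⊥-elim (0∉Bj here)
    difference : ∀ s t → - 1ℚ * s + 1ℚ * t ≡ t - s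
    difference = solve-∀ ℚ-ring

module Chains {A : Set} {_<_ : Rel A 0ℓ} (<-isDecStrictPartialOrder : IsDecStrictPartialOrder _≡_ _<_) where

  open import Data.Bool using (Bool; true; false)
  open import Data.Empty using (⊥-elim)
  open import Data.List using (List; []; _∷_; _++_; _∷ʳ_; map; filter; length)
  open import Data.List.Membership.Propositional using (_∈_; _∉_)
  open import Data.List.Membership.Propositional.Properties using (∈-++⁺ˡ; ∈-++⁺ʳ; ∈-++⁻; ∈-map⁻; ∈-filter⁻; ∈-filter⁺)
  open import Data.List.Membership.Propositional.Properties.WithK using (unique∧set⇒bag)
  open import Data.List.Properties using (++-assoc)
  open import Data.List.Relation.Binary.BagAndSetEquality using (∼bag⇒↭)
  open import Data.List.Relation.Binary.Permutation.Propositional using (_↭_; ↭-refl; ↭-trans; ↭-sym; prep; swap; ↭⇒↭ₛ)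
  open import Data.List.Relation.Binary.Permutation.Propositional.Properties using (∈-resp-↭; shift)
  open import Data.List.Relation.Unary.All using (All; []; _∷_; lookup)
  import Data.List.Relation.Unary.All as All
  import Data.List.Relation.Unary.AllPairs as AllPairs
  open import Data.List.Relation.Unary.AllPairs using (AllPairs; []; _∷_)
  open import Data.List.Relation.Unary.Any using (here; there)
  open import Data.List.Relation.Unary.Unique.Propositional using (Unique)
  import Data.List.Relation.Unary.Unique.Propositional.Properties as Unique
  open import Data.Nat using (suc)
  open import Data.Product using (_×_; _,_; proj₁; proj₂; ∃-syntax)
  open import Data.Rational using (ℚ; 0ℚ; 1ℚ; _+_; _*_)
  open import Data.Rational.Properties using (+-identityʳ; +-comm; *-identityˡ; *-zeroˡ; *-zeroʳ)
  open import Data.Sum using (_⊎_; inj₁; inj₂; [_,_]′; map₁)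
  open import Function.Bundles using (mk⇔)
  open import Relation.Binary.PropositionalEquality
  open import Relation.Nullary using (Dec; does; yes; no; ¬_; contradiction)
  open import Relation.Nullary.Decidable using (_×-dec_; dec-true; dec-false)

  open import Defs using (sublists)
  open Rational
  open BigOperators


  open ≡-Reasoning

  open IsDecStrictPartialOrder <-isDecStrictPartialOrder using (_≟_; _<?_; irrefl; asym) renaming (trans to <-trans)
  open import Data.List.Membership.DecPropositional _≟_ using (_∈?_)
  import Data.List.Relation.Binary.Permutation.Setoid.Properties (setoid A) as ↭ₛ

  Comparable : A → A → Set
  Comparable x y = x < y ⊎ y < x

  infixr 5 _↗_

  data Ascending : A → List A → A → Set where
    end : ∀ {a b} → a < b → Ascending a [] b
    _↗_ : ∀ {a x Q b} → a < x → Ascending x Q b → Ascending a (x ∷ Q) b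

  ascending⇒< : ∀ {a Q b} → Ascending a Q b → a < b
  ascending⇒< (end a<b)     = a<b
  ascending⇒< (a<x ↗ x↗b) = <-trans a<x (ascending⇒< x↗b)

  ascending⇒<∈ : ∀ {a Q b y} → Ascending a Q b → y ∈ Q → a < y
  ascending⇒<∈ (a<x ↗ x↗b) (here refl)  = a<x
  ascending⇒<∈ (a<x ↗ x↗b) (there y∈Q) = <-trans a<x (ascending⇒<∈ x↗b y∈Q)

  ascending⇒chain : ∀ {a Q b} → Ascending a Q b → AllPairs Comparable Q
  ascending⇒chain (end _)           = []
  ascending⇒chain {Q = x ∷ Q} (_ ↗ x↗b) = all-above Q (ascending⇒<∈ x↗b) ∷ ascending⇒chain x↗b
    where
    all-above : ∀ {x} ys → (∀ {y} → y ∈ ys → x < y) → All (Comparable x) ys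
    all-above []       _   = []
    all-above (y ∷ ys) x<_ = inj₁ (x< here refl) ∷ all-above ys (λ y∈ys → x< there y∈ys)

  comparable-sym : ∀ {x y} → Comparable x y → Comparable y x
  comparable-sym (inj₁ x<y) = inj₂ x<y
  comparable-sym (inj₂ y<x) = inj₁ y<x

  chain-resp-↭ : ∀ {S S′} → S′ ↭ S → AllPairs Comparable S′ → AllPairs Comparable S
  chain-resp-↭ S′↭S = ↭ₛ.AllPairs-resp-↭ comparable-sym (resp₂ Comparable) (↭⇒↭ₛ S′↭S)

  chain-comparable : ∀ {S x y} → AllPairs Comparable S → x ∈ S → y ∈ S → x ≢ y → Comparable x y
  chain-comparable (x~ ∷ _)  (here refl)  (here refl)  x≢y = ⊥-elim (x≢y refl)
  chain-comparable (x~ ∷ _)  (here refl)  (there y∈S) _   = lookup x~ y∈S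
  chain-comparable (y~ ∷ _)  (there x∈S) (here refl)  _   = comparable-sym (lookup y~ x∈S)
  chain-comparable (_ ∷ S~) (there x∈S) (there y∈S) x≢y = chain-comparable S~ x∈S y∈S x≢y

  sublists-⊆ : ∀ {L S : List A} {y} → S ∈ sublists L → y ∈ S → y ∈ L
  sublists-⊆ {[]}    (here refl) ()
  sublists-⊆ {x ∷ L} S∈ y∈S with ∈-++⁻ (map (x ∷_) (sublists L)) S∈
  ... | inj₂ S∈L = there (sublists-⊆ S∈L y∈S)
  ... | inj₁ x∷S′∈ with ∈-map⁻ (x ∷_) x∷S′∈
  ...   | S′ , S′∈ , refl with y∈S
  ...     | here refl   = here refl
  ...     | there y∈S′ = there (sublists-⊆ S′∈ y∈S′)

  between? : ∀ a x b → Dec (a < x × x < b)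
  between? a x b = (a <? x) ×-dec (x <? b)

  gaps : A → List A → A → List (A × A)
  gaps a []      b = (a , b) ∷ []
  gaps a (x ∷ Q) b = (a , x) ∷ gaps x Q b

  length-gaps : ∀ a Q b → length (gaps a Q b) ≡ suc (length Q)
  length-gaps a []      b = refl
  length-gaps a (x ∷ Q) b = cong suc (length-gaps x Q b)

  gaps-< : ∀ {a Q b g} → Ascending a Q b → g ∈ gaps a Q b → proj₁ g < proj₂ g
  gaps-< (end a<b)     (here refl)   = a<b
  gaps-< (a<x ↗ _)     (here refl)   = a<x
  gaps-< (_   ↗ x↗b) (there g∈gs) = gaps-< x↗b g∈gs

  fits : A → A → List A → A → Bool
  fits x a []      b with between? a x b
  ... | yes _ = true
  ... | no  _ = false
  fits x a (y ∷ Q) b with between? a x y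
  ... | yes _ = true
  ... | no  _ = fits x y Q b

  insert : A → A → List A → A → List A
  insert x a []      b = x ∷ []
  insert x a (y ∷ Q) b with between? a x y
  ... | yes _ = x ∷ y ∷ Q
  ... | no  _ = y ∷ insert x y Q b

  fits⇒< : ∀ {x a Q b} → Ascending a Q b → fits x a Q b ≡ true → a < x
  fits⇒< {x} {a} {b = b} (end _) fits≡true with between? a x b
  ... | yes (a<x , _) = a<x
  ... | no  _         with () ← fits≡true
  fits⇒< {x} {a} {y ∷ Q} (a<y ↗ y↗b) fits≡true with between? a x y
  ... | yes (a<x , _) = a<x
  ... | no  _         = <-trans a<y (fits⇒< y↗b fits≡true)

  fits-¬< : ∀ {x a Q b} → Ascending a Q b → ¬ a < x → fits x a Q b ≡ false
  fits-¬< {x} {a} {Q} {b} a↗b a≮x with fits x a Q b in fits≡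
  ... | false = refl
  ... | true  = ⊥-elim (a≮x (fits⇒< a↗b fits≡))

  fits-∈ : ∀ {x a Q b} → Ascending a Q b → x ∈ Q → fits x a Q b ≡ false
  fits-∈ {x} {a} {y ∷ Q} (a<y ↗ y↗b) x∈y∷Q with between? a x y | x∈y∷Q
  ... | yes (_ , x<y) | here refl   = ⊥-elim (irrefl refl x<y)
  ... | yes (_ , x<y) | there x∈Q = ⊥-elim (asym x<y (ascending⇒<∈ y↗b x∈Q))
  ... | no _          | here refl   = fits-¬< y↗b (irrefl refl)
  ... | no _          | there x∈Q = fits-∈ y↗b x∈Q

  fits-complete : ∀ {x a Q b} → Ascending a Q b → a < x → x < b → (∀ {y} → y ∈ Q → Comparable y x) → fits x a Q b ≡ true
  fits-complete {x} {a} {b = b} (end _) a<x x<b _ with between? a x b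
  ... | yes _           = refl
  ... | no  ¬a<x<b = ⊥-elim (¬a<x<b (a<x , x<b))
  fits-complete {x} {a} {y ∷ Q} (a<y ↗ y↗b) a<x x<b comparable with between? a x y | comparable (here refl)
  ... | yes _           | _       = refl
  ... | no  _           | inj₁ y<x = fits-complete y↗b y<x x<b (λ y∈Q → comparable (there y∈Q))
  ... | no  ¬a<x<y | inj₂ x<y = ⊥-elim (¬a<x<y (a<x , x<y))

  insert-ascending : ∀ {x a Q b} → Ascending a Q b → fits x a Q b ≡ true → Ascending a (insert x a Q b) b
  insert-ascending {x} {a} {b = b} (end _) fits≡true with between? a x b
  ... | yes (a<x , x<b) = a<x ↗ end x<b
  insert-ascending {x} {a} {y ∷ Q} (a<y ↗ y↗b) fits≡true with between? a x y
  ... | yes (a<x , x<y) = a<x ↗ x<y ↗ y↗b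
  ... | no  _           = a<y ↗ insert-ascending y↗b fits≡true

  insert-↭ : ∀ x a Q b → insert x a Q b ↭ x ∷ Q
  insert-↭ x a []      b = ↭-refl
  insert-↭ x a (y ∷ Q) b with between? a x y
  ... | yes _ = ↭-refl
  ... | no  _ = ↭-trans (prep y (insert-↭ x y Q b)) (swap y x ↭-refl)

  sort : ∀ {a b} (Y : List A) → AllPairs Comparable Y → All (λ y → a < y × y < b) Y → a < b →
    ∃[ Q ] Ascending a Q b × Y ↭ Q
  sort []      _            _                   a<b = [] , end a<b , ↭-refl
  sort {a} {b} (y ∷ Y) (y~Y ∷ Y-chain) ((a<y , y<b) ∷ Y-between) a<b with sort Y Y-chain Y-between a<b
  ... | Q , a↗b , Y↭Q = insert y a Q b , insert-ascending a↗b y-fits , ↭-trans (prep y Y↭Q) (↭-sym (insert-↭ y a Q b))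
    where
    y-fits : fits y a Q b ≡ true
    y-fits = fits-complete a↗b a<y y<b (λ z∈Q → flip (lookup y~Y (∈-resp-↭ (↭-sym Y↭Q) z∈Q)))
      where
      flip : ∀ {z} → Comparable y z → Comparable z y
      flip (inj₁ y<z) = inj₂ y<z
      flip (inj₂ z<y) = inj₁ z<y

  module ChainSum (φ : A → A → ℚ) (φ-supported : ∀ {a b} → ¬ a < b → φ a b ≡ 0ℚ) where

    -- chainSum L a b is the sum of φ a x₁ * φ x₁ x₂ * ⋯ * φ xₖ b over the chains
    -- a < x₁ < ⋯ < xₖ < b of elements of L; the recursion splits off the chains
    -- through the head of L, and φ vanishing off _<_ discards everything else.
    chainSum : List A → A → A → ℚ
    chainSum []      a b = φ a b
    chainSum (x ∷ L) a b = chainSum L a b + chainSum L a x * chainSum L x b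

    chainSum-supported : ∀ L {a b} → ¬ a < b → chainSum L a b ≡ 0ℚ
    chainSum-supported []      a≮b = φ-supported a≮b
    chainSum-supported (x ∷ L) {a} {b} a≮b with a <? x | x <? b
    ... | yes a<x | yes x<b = ⊥-elim (a≮b (<-trans a<x x<b))
    ... | no  a≮x | _       = begin
      chainSum L a b + chainSum L a x * chainSum L x b  ≡⟨ cong₂ (λ s t → s + t * chainSum L x b) (chainSum-supported L a≮b) (chainSum-supported L a≮x) ⟩
      0ℚ + 0ℚ * chainSum L x b                          ≡⟨ cong (0ℚ +_) (*-zeroˡ (chainSum L x b)) ⟩
      0ℚ                                                ∎
    ... | yes _   | no  x≮b = begin
      chainSum L a b + chainSum L a x * chainSum L x b  ≡⟨ cong₂ (λ s t → s + chainSum L a x * t) (chainSum-supported L a≮b) (chainSum-supported L x≮b) ⟩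
      0ℚ + chainSum L a x * 0ℚ                          ≡⟨ cong (0ℚ +_) (*-zeroʳ (chainSum L a x)) ⟩
      0ℚ                                                ∎

    chainSum-∷-from : ∀ x L b → chainSum (x ∷ L) x b ≡ chainSum L x b
    chainSum-∷-from x L b = begin
      chainSum L x b + chainSum L x x * chainSum L x b  ≡⟨ cong (λ t → chainSum L x b + t * chainSum L x b) (chainSum-supported L (irrefl refl)) ⟩
      chainSum L x b + 0ℚ * chainSum L x b              ≡⟨ cong (chainSum L x b +_) (*-zeroˡ (chainSum L x b)) ⟩
      chainSum L x b + 0ℚ                               ≡⟨ +-identityʳ _ ⟩
      chainSum L x b                                    ∎

    chainSum-∷-to : ∀ x L a → chainSum (x ∷ L) a x ≡ chainSum L a x
    chainSum-∷-to x L a = begin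
      chainSum L a x + chainSum L a x * chainSum L x x  ≡⟨ cong (λ t → chainSum L a x + chainSum L a x * t) (chainSum-supported L (irrefl refl)) ⟩
      chainSum L a x + chainSum L a x * 0ℚ              ≡⟨ cong (chainSum L a x +_) (*-zeroʳ (chainSum L a x)) ⟩
      chainSum L a x + 0ℚ                               ≡⟨ +-identityʳ _ ⟩
      chainSum L a x                                    ∎

    chainSum-first-step : ∀ L a b → chainSum L a b ≡ φ a b + ∑[ c ∈ L ] (φ a c * chainSum L c b)
    chainSum-first-step []      a b = sym (+-identityʳ (φ a b))
    chainSum-first-step (x ∷ L) a b = begin
      C a b + C a x * C x b
        ≡⟨ cong₂ (λ s t → s + t * C x b) (chainSum-first-step L a b) (chainSum-first-step L a x) ⟩
      (φ a b + ∑[ c ∈ L ] (φ a c * C c b)) + (φ a x + ∑[ c ∈ L ] (φ a c * C c x)) * C x b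
        ≡⟨ regroup (φ a b) (φ a x) (C x b) _ _ ⟩
      φ a b + (φ a x * C x b + (∑[ c ∈ L ] (φ a c * C c b) + ∑[ c ∈ L ] (φ a c * C c x) * C x b))
        ≡⟨ cong (λ t → φ a b + (φ a x * C x b + (∑[ c ∈ L ] (φ a c * C c b) + t))) (∑-*ʳ (C x b) L (λ c → φ a c * C c x)) ⟩
      φ a b + (φ a x * C x b + (∑[ c ∈ L ] (φ a c * C c b) + ∑[ c ∈ L ] (φ a c * C c x * C x b)))
        ≡⟨ cong (λ t → φ a b + (φ a x * C x b + t)) (∑-+ L _ _) ⟨
      φ a b + (φ a x * C x b + ∑[ c ∈ L ] (φ a c * C c b + φ a c * C c x * C x b))
        ≡⟨ cong₂ (λ s t → φ a b + (φ a x * s + t)) (chainSum-∷-from x L b) (∑-cong L (λ {c} _ → expand (φ a c) (C c b) (C c x) (C x b))) ⟨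
      φ a b + ∑[ c ∈ x ∷ L ] (φ a c * chainSum (x ∷ L) c b) ∎
      where
      C = chainSum L
      regroup : ∀ p q r s t → (p + s) + (q + t) * r ≡ p + (q * r + (s + t * r))
      regroup = solve-∀ ℚ-ring
      expand : ∀ f u v w → f * (u + v * w) ≡ f * u + f * v * w
      expand = solve-∀ ℚ-ring

    chainSum-last-step : ∀ L a b → chainSum L a b ≡ φ a b + ∑[ c ∈ L ] (chainSum L a c * φ c b)
    chainSum-last-step []      a b = sym (+-identityʳ (φ a b))
    chainSum-last-step (x ∷ L) a b = begin
      C a b + C a x * C x b
        ≡⟨ cong₂ (λ s t → s + C a x * t) (chainSum-last-step L a b) (chainSum-last-step L x b) ⟩
      (φ a b + ∑[ c ∈ L ] (C a c * φ c b)) + C a x * (φ x b + ∑[ c ∈ L ] (C x c * φ c b))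
        ≡⟨ regroup (φ a b) (φ x b) (C a x) _ _ ⟩
      φ a b + (C a x * φ x b + (∑[ c ∈ L ] (C a c * φ c b) + C a x * ∑[ c ∈ L ] (C x c * φ c b)))
        ≡⟨ cong (λ t → φ a b + (C a x * φ x b + (∑[ c ∈ L ] (C a c * φ c b) + t))) (∑-*ˡ (C a x) L (λ c → C x c * φ c b)) ⟩
      φ a b + (C a x * φ x b + (∑[ c ∈ L ] (C a c * φ c b) + ∑[ c ∈ L ] (C a x * (C x c * φ c b))))
        ≡⟨ cong (λ t → φ a b + (C a x * φ x b + t)) (∑-+ L _ _) ⟨
      φ a b + (C a x * φ x b + ∑[ c ∈ L ] (C a c * φ c b + C a x * (C x c * φ c b)))
        ≡⟨ cong₂ (λ s t → φ a b + (s * φ x b + t)) (chainSum-∷-to x L a) (∑-cong L (λ {c} _ → expand (C a c) (C a x) (C x c) (φ c b))) ⟨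
      φ a b + ∑[ c ∈ x ∷ L ] (chainSum (x ∷ L) a c * φ c b) ∎
      where
      C = chainSum L
      regroup : ∀ p q r s t → (p + s) + r * (q + t) ≡ p + (r * q + (s + r * t))
      regroup = solve-∀ ℚ-ring
      expand : ∀ u v w f → (u + v * w) * f ≡ u * f + v * (w * f)
      expand = solve-∀ ℚ-ring

    chainSum-between : ∀ L {a x b} → ¬ (a < x × x < b) → chainSum L a x * chainSum L x b ≡ 0ℚ
    chainSum-between L {a} {x} {b} ¬a<x<b with a <? x | x <? b
    ... | yes a<x | yes x<b = ⊥-elim (¬a<x<b (a<x , x<b))
    ... | no  a≮x | _       = trans (cong (_* chainSum L x b) (chainSum-supported L a≮x)) (*-zeroˡ (chainSum L x b))
    ... | yes _   | no  x≮b = trans (cong (chainSum L a x *_) (chainSum-supported L x≮b)) (*-zeroʳ (chainSum L a x))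

    -- A chain through every element of Q is a concatenation of chains in the gaps of Q,
    -- so this is the sum over the chains from a to b through Q.
    chainSumThrough : List A → A → List A → A → ℚ
    chainSumThrough L a Q b = ∏[ g ∈ gaps a Q b ] chainSum L (proj₁ g) (proj₂ g)

    chainSumThrough-∷ : ∀ x L {a Q b} → Ascending a Q b →
      chainSumThrough (x ∷ L) a Q b ≡ chainSumThrough L a Q b + 𝟙 (fits x a Q b) * chainSumThrough L a (insert x a Q b) b
    chainSumThrough-∷ x L {a} {[]} {b} _ with between? a x b
    ... | yes _      = expand (chainSum L a b) (chainSum L a x) (chainSum L x b)
      where
      expand : ∀ s t u → (s + t * u) * 1ℚ ≡ s * 1ℚ + 1ℚ * (t * (u * 1ℚ))
      expand = solve-∀ ℚ-ring
    ... | no ¬a<x<b = begin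
      (chainSum L a b + chainSum L a x * chainSum L x b) * 1ℚ  ≡⟨ cong (λ t → (chainSum L a b + t) * 1ℚ) (chainSum-between L ¬a<x<b) ⟩
      (chainSum L a b + 0ℚ) * 1ℚ                               ≡⟨ drop (chainSum L a b) (chainSum L a x) (chainSum L x b) ⟩
      chainSum L a b * 1ℚ + 0ℚ * (chainSum L a x * (chainSum L x b * 1ℚ)) ∎
      where
      drop : ∀ s t u → (s + 0ℚ) * 1ℚ ≡ s * 1ℚ + 0ℚ * (t * (u * 1ℚ))
      drop = solve-∀ ℚ-ring
    chainSumThrough-∷ x L {a} {y ∷ Q} {b} (a<y ↗ y↗b) with between? a x y
    ... | yes (_ , x<y) = begin
      (C a y + C a x * C x y) * T′ y Q
        ≡⟨ cong (λ t → (C a y + C a x * C x y) * t) (chainSumThrough-∷ x L y↗b) ⟩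
      (C a y + C a x * C x y) * (T y Q + 𝟙 (fits x y Q b) * T y (insert x y Q b))
        ≡⟨ cong (λ f → (C a y + C a x * C x y) * (T y Q + 𝟙 f * T y (insert x y Q b))) (fits-¬< y↗b (asym x<y)) ⟩
      (C a y + C a x * C x y) * (T y Q + 0ℚ * T y (insert x y Q b))
        ≡⟨ expand (C a y) (C a x) (C x y) (T y Q) (T y (insert x y Q b)) ⟩
      C a y * T y Q + 1ℚ * (C a x * (C x y * T y Q)) ∎
      where
      C = chainSum L
      T = λ c R → chainSumThrough L c R b
      T′ = λ c R → chainSumThrough (x ∷ L) c R b
      expand : ∀ s t u v w → (s + t * u) * (v + 0ℚ * w) ≡ s * v + 1ℚ * (t * (u * v))
      expand = solve-∀ ℚ-ring
    ... | no ¬a<x<y = begin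
      (C a y + C a x * C x y) * T′ y Q
        ≡⟨ cong₂ (λ s t → (C a y + s) * t) (chainSum-between L ¬a<x<y) (chainSumThrough-∷ x L y↗b) ⟩
      (C a y + 0ℚ) * (T y Q + 𝟙 (fits x y Q b) * T y (insert x y Q b))
        ≡⟨ expand (C a y) (T y Q) (𝟙 (fits x y Q b)) (T y (insert x y Q b)) ⟩
      C a y * T y Q + 𝟙 (fits x y Q b) * (C a y * T y (insert x y Q b)) ∎
      where
      C = chainSum L
      T = λ c R → chainSumThrough L c R b
      T′ = λ c R → chainSumThrough (x ∷ L) c R b
      expand : ∀ s v i w → (s + 0ℚ) * (v + i * w) ≡ s * v + i * (s * w)
      expand = solve-∀ ℚ-ring

    module _ {a b : A} (W : List A → ℚ) (W-↭ : ∀ {S S′} → S ↭ S′ → W S ≡ W S′)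
             (W-ascending : ∀ {Q} → Ascending a Q b → W Q ≡ chainSumThrough [] a Q b)
             (𝓕 : List A) (good? : ∀ S → Dec (AllPairs Comparable S × All (_∈ S) 𝓕)) where

      private
        Φ : List A → ℚ
        Φ S = 𝟙 (does (good? S)) * W S

        extensions : List A → List A → ℚ
        extensions P L = ∑[ S ∈ sublists L ] Φ (P ++ S)

        extensions-∷ : ∀ P x L → extensions P (x ∷ L) ≡ extensions (P ∷ʳ x) L + extensions P L
        extensions-∷ P x L = begin
          ∑ (map (x ∷_) (sublists L) ++ sublists L) (λ S → Φ (P ++ S))
            ≡⟨ ∑-++ (map (x ∷_) (sublists L)) (sublists L) (λ S → Φ (P ++ S)) ⟩
          ∑ (map (x ∷_) (sublists L)) (λ S → Φ (P ++ S)) + extensions P L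
            ≡⟨ cong (_+ extensions P L) (∑-map (x ∷_) (sublists L) (λ S → Φ (P ++ S))) ⟩
          ∑[ S ∈ sublists L ] Φ (P ++ x ∷ S) + extensions P L
            ≡⟨ cong (_+ extensions P L) (∑-cong (sublists L) (λ {S} _ → cong Φ (++-assoc P (x ∷ []) S))) ⟨
          extensions (P ∷ʳ x) L + extensions P L ∎

        extensions-bad : ∀ P L → (∀ {S} → S ∈ sublists L → ¬ (AllPairs Comparable (P ++ S) × All (_∈ (P ++ S)) 𝓕)) →
          extensions P L ≡ 0ℚ
        extensions-bad P L bad = ∑-zero (sublists L) (λ {S} S∈ →
          trans (cong (λ g → 𝟙 g * W (P ++ S)) (dec-false (good? (P ++ S)) (bad S∈))) (*-zeroˡ (W (P ++ S))))

        disjoint-∷ʳ : ∀ {x : A} {L P} → All (x ≢_) L → (∀ {y} → y ∈ x ∷ L → y ∉ P) → ∀ {y} → y ∈ L → y ∉ P ∷ʳ x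
        disjoint-∷ʳ {P = P} x∉L disjoint y∈L y∈P∷ʳx with ∈-++⁻ P y∈P∷ʳx
        ... | inj₁ y∈P       = disjoint (there y∈L) y∈P
        ... | inj₂ (here refl) = lookup x∉L y∈L refl

        extensions-missing : ∀ {x P L} → x ∈ 𝓕 → x ∉ P → All (x ≢_) L → extensions P L ≡ 0ℚ
        extensions-missing {x} {P} {L} x∈𝓕 x∉P x∉L = extensions-bad P L λ S∈ (_ , cover) →
          [ x∉P , (λ x∈S → lookup x∉L (sublists-⊆ S∈ x∈S) refl) ]′ (∈-++⁻ P (lookup cover x∈𝓕))

        extensions-incomparable : ∀ {x P L Q} → x ∉ 𝓕 → x ∉ P → a < x → x < b → Ascending a Q b →
          Q ↭ P ++ filter (_∈? 𝓕) L → fits x a Q b ≡ false → extensions (P ∷ʳ x) L ≡ 0ℚ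
        extensions-incomparable {x} {P} {L} {Q} x∉𝓕 x∉P a<x x<b a↗b Q↭ ¬fits =
          extensions-bad (P ∷ʳ x) L λ _ good → contradiction (trans (sym (good⇒fits good)) ¬fits) λ ()
          where
          good⇒fits : ∀ {S} → AllPairs Comparable ((P ∷ʳ x) ++ S) × All (_∈ ((P ∷ʳ x) ++ S)) 𝓕 → fits x a Q b ≡ true
          good⇒fits {S} (chain , cover) = fits-complete a↗b a<x x<b comparable
            where
            x∈ : x ∈ (P ∷ʳ x) ++ S
            x∈ = ∈-++⁺ˡ (∈-++⁺ʳ P (here refl))
            comparable : ∀ {y} → y ∈ Q → Comparable y x
            comparable y∈Q with ∈-++⁻ P (∈-resp-↭ Q↭ y∈Q)
            ... | inj₁ y∈P = chain-comparable chain (∈-++⁺ˡ (∈-++⁺ˡ y∈P)) x∈ (λ { refl → x∉P y∈P })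
            ... | inj₂ y∈F with ∈-filter⁻ (_∈? 𝓕) {xs = L} y∈F
            ...   | _ , y∈𝓕 = chain-comparable chain (lookup cover y∈𝓕) x∈ (λ { refl → x∉𝓕 y∈𝓕 })

        insert-↭-∷ʳ : ∀ {x Q P R} → Q ↭ P ++ R → insert x a Q b ↭ (P ∷ʳ x) ++ R
        insert-↭-∷ʳ {x} {Q} {P} {R} Q↭ = ↭-trans (insert-↭ x a Q b) (↭-trans (prep x Q↭)
          (subst (x ∷ P ++ R ↭_) (sym (++-assoc P (x ∷ []) R)) (↭-sym (shift x P R))))

        extensions-chainSumThrough : ∀ L P {Q} → Unique L → (∀ {y} → y ∈ L → y ∉ P) → All (λ y → a < y × y < b) L →
          (∀ {F} → F ∈ 𝓕 → F ∈ P ⊎ F ∈ L) → Ascending a Q b → Q ↭ P ++ filter (_∈? 𝓕) L →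
          extensions P L ≡ chainSumThrough L a Q b
        extensions-chainSumThrough [] P {Q} _ _ _ covered a↗b Q↭ = begin
          Φ (P ++ []) + 0ℚ  ≡⟨ +-identityʳ _ ⟩
          Φ (P ++ [])       ≡⟨ cong (λ g → 𝟙 g * W (P ++ [])) (dec-true (good? (P ++ [])) (chain-resp-↭ Q↭ (ascending⇒chain a↗b) , cover)) ⟩
          1ℚ * W (P ++ [])  ≡⟨ *-identityˡ _ ⟩
          W (P ++ [])       ≡⟨ W-↭ Q↭ ⟨
          W Q               ≡⟨ W-ascending a↗b ⟩
          chainSumThrough [] a Q b ∎
          where
          cover : All (_∈ (P ++ [])) 𝓕
          cover = All.tabulate (λ F∈𝓕 → [ ∈-++⁺ˡ , (λ ()) ]′ (covered F∈𝓕))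
        extensions-chainSumThrough (x ∷ L) P {Q} (x∉L ∷ L!) disjoint ((a<x , x<b) ∷ between) covered a↗b Q↭ with x ∈? 𝓕
        ... | yes x∈𝓕 = begin
          extensions P (x ∷ L)
            ≡⟨ extensions-∷ P x L ⟩
          extensions (P ∷ʳ x) L + extensions P L
            ≡⟨ cong₂ _+_ (extensions-chainSumThrough L (P ∷ʳ x) L! (disjoint-∷ʳ {P = P} x∉L disjoint) between covered′ a↗b
                            (subst (Q ↭_) (sym (++-assoc P (x ∷ []) (filter (_∈? 𝓕) L))) Q↭))
                         (extensions-missing x∈𝓕 (disjoint (here refl)) x∉L) ⟩
          chainSumThrough L a Q b + 0ℚ
            ≡⟨ cong (chainSumThrough L a Q b +_) (*-zeroˡ (chainSumThrough L a (insert x a Q b) b)) ⟨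
          chainSumThrough L a Q b + 0ℚ * chainSumThrough L a (insert x a Q b) b
            ≡⟨ cong (λ f → chainSumThrough L a Q b + 𝟙 f * chainSumThrough L a (insert x a Q b) b)
                    (fits-∈ a↗b (∈-resp-↭ (↭-sym Q↭) (∈-++⁺ʳ P (here refl)))) ⟨
          chainSumThrough L a Q b + 𝟙 (fits x a Q b) * chainSumThrough L a (insert x a Q b) b
            ≡⟨ chainSumThrough-∷ x L a↗b ⟨
          chainSumThrough (x ∷ L) a Q b ∎
          where
          covered′ : ∀ {F} → F ∈ 𝓕 → F ∈ P ∷ʳ x ⊎ F ∈ L
          covered′ F∈𝓕 with covered F∈𝓕
          ... | inj₁ F∈P          = inj₁ (∈-++⁺ˡ F∈P)
          ... | inj₂ (here refl)  = inj₁ (∈-++⁺ʳ P (here refl))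
          ... | inj₂ (there F∈L) = inj₂ F∈L
        ... | no x∉𝓕 = begin
          extensions P (x ∷ L)
            ≡⟨ extensions-∷ P x L ⟩
          extensions (P ∷ʳ x) L + extensions P L
            ≡⟨ cong₂ _+_ with-x (extensions-chainSumThrough L P L! (λ y∈L → disjoint (there y∈L)) between covered′ a↗b Q↭) ⟩
          𝟙 (fits x a Q b) * chainSumThrough L a (insert x a Q b) b + chainSumThrough L a Q b
            ≡⟨ +-comm (𝟙 (fits x a Q b) * chainSumThrough L a (insert x a Q b) b) (chainSumThrough L a Q b) ⟩
          chainSumThrough L a Q b + 𝟙 (fits x a Q b) * chainSumThrough L a (insert x a Q b) b
            ≡⟨ chainSumThrough-∷ x L a↗b ⟨
          chainSumThrough (x ∷ L) a Q b ∎
          where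
          covered′ : ∀ {F} → F ∈ 𝓕 → F ∈ P ⊎ F ∈ L
          covered′ F∈𝓕 with covered F∈𝓕
          ... | inj₁ F∈P          = inj₁ F∈P
          ... | inj₂ (here refl)  = ⊥-elim (x∉𝓕 F∈𝓕)
          ... | inj₂ (there F∈L) = inj₂ F∈L
          with-x : extensions (P ∷ʳ x) L ≡ 𝟙 (fits x a Q b) * chainSumThrough L a (insert x a Q b) b
          with-x with fits x a Q b in fits≡
          ... | false = trans (extensions-incomparable {L = L} x∉𝓕 (disjoint (here refl)) a<x x<b a↗b Q↭ fits≡)
                              (sym (*-zeroˡ (chainSumThrough L a (insert x a Q b) b)))
          ... | true  = trans (extensions-chainSumThrough L (P ∷ʳ x) L! (disjoint-∷ʳ {P = P} x∉L disjoint) between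
                                 (λ F∈𝓕 → map₁ ∈-++⁺ˡ (covered′ F∈𝓕)) (insert-ascending a↗b fits≡) (insert-↭-∷ʳ {P = P} Q↭))
                              (sym (*-identityˡ (chainSumThrough L a (insert x a Q b) b)))

      ∑-sublists-chains : ∀ L {Q} → Unique L → All (λ y → a < y × y < b) L → All (_∈ L) 𝓕 → Ascending a Q b → Q ↭ 𝓕 →
        ∑[ S ∈ sublists L ] (𝟙 (does (good? S)) * W S) ≡ chainSumThrough L a Q b
      ∑-sublists-chains L L! between 𝓕⊆L a↗b Q↭𝓕 =
        extensions-chainSumThrough L [] L! (λ _ ()) between (λ F∈𝓕 → inj₂ (lookup 𝓕⊆L F∈𝓕)) a↗b (↭-trans Q↭𝓕 (↭-sym filtered↭𝓕))
        where
        𝓕! : Unique 𝓕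
        𝓕! = ↭ₛ.Unique-resp-↭ (↭⇒↭ₛ Q↭𝓕) (AllPairs.map comparable⇒≢ (ascending⇒chain a↗b))
          where
          comparable⇒≢ : ∀ {x y} → Comparable x y → x ≢ y
          comparable⇒≢ (inj₁ x<y) refl = irrefl refl x<y
          comparable⇒≢ (inj₂ y<x) refl = irrefl refl y<x
        filtered↭𝓕 : filter (_∈? 𝓕) L ↭ 𝓕
        filtered↭𝓕 = ∼bag⇒↭ (unique∧set⇒bag (Unique.filter⁺ (_∈? 𝓕) L!) 𝓕!
          (mk⇔ (λ y∈ → proj₂ (∈-filter⁻ (_∈? 𝓕) {xs = L} y∈)) (λ y∈𝓕 → ∈-filter⁺ (_∈? 𝓕) (lookup 𝓕⊆L y∈𝓕) y∈𝓕)))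

module Duality where

  open import Data.Fin.Subset using (Subset; _⊂_)
  open import Data.Fin.Subset.Properties using (_⊂?_; ⊂-isDecStrictPartialOrder; ⊂-irref)
  open import Data.Nat using (ℕ)
  open import Data.Rational using (ℚ; 0ℚ; 1ℚ; _+_; _*_; _-_; -_)
  open import Data.Rational.Properties using (+-comm; +-identityˡ; +-identityʳ; *-identityˡ; *-identityʳ; *-zeroˡ; *-comm; *-distribʳ-+)
  open import Relation.Binary.PropositionalEquality
  import Relation.Binary.Reasoning.Setoid as SetoidReasoning
  open import Relation.Nullary using (does; ¬_)
  open import Relation.Nullary.Decidable using (dec-false)

  open import Defs using (allSubsets; _^ℚ_; _/ℚ_; _≟ₛ_)
  open Rational
  open BigOperators
  open Incidence

  module _ {n : ℕ} (r : Subset n → ℕ) where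

    twist : ℚ → Kernel n → Kernel n
    twist s F A B = s ^ℚ r B * (1ℚ /ℚ s) ^ℚ r A * F A B

    module _ {s : ℚ} (s≢0 : s ≢ 0ℚ) where

      private
        s·1/s : s * (1ℚ /ℚ s) ≡ 1ℚ
        s·1/s = *-1/ℚ s≢0
        1/s·s : (1ℚ /ℚ s) * s ≡ 1ℚ
        1/s·s = trans (*-comm _ s) s·1/s

      twist-cong : ∀ {F G} → F ≈ G → twist s F ≈ twist s G
      twist-cong F≈G A B = cong (s ^ℚ r B * (1ℚ /ℚ s) ^ℚ r A *_) (F≈G A B)

      twist-⋆ : ∀ F G → twist s (F ⋆ G) ≈ twist s F ⋆ twist s G
      twist-⋆ F G A B = begin
        s ^ℚ r B * (1ℚ /ℚ s) ^ℚ r A * ∑[ C ∈ allSubsets n ] (F A C * G C B)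
          ≡⟨ ∑-*ˡ (s ^ℚ r B * (1ℚ /ℚ s) ^ℚ r A) (allSubsets n) _ ⟩
        ∑[ C ∈ allSubsets n ] (s ^ℚ r B * (1ℚ /ℚ s) ^ℚ r A * (F A C * G C B))
          ≡⟨ ∑-cong (allSubsets n) (λ {C} _ → telescope C) ⟩
        ∑[ C ∈ allSubsets n ] (twist s F A C * twist s G C B) ∎
        where
        open ≡-Reasoning
        regroup : ∀ b a c c′ f g → (b * a) * (f * g) * (c′ * c) ≡ (c * a * f) * (b * c′ * g)
        regroup = solve-∀ ℚ-ring
        telescope : ∀ C → s ^ℚ r B * (1ℚ /ℚ s) ^ℚ r A * (F A C * G C B) ≡ twist s F A C * twist s G C B
        telescope C = begin
          s ^ℚ r B * (1ℚ /ℚ s) ^ℚ r A * (F A C * G C B)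
            ≡⟨ *-identityʳ _ ⟨
          s ^ℚ r B * (1ℚ /ℚ s) ^ℚ r A * (F A C * G C B) * 1ℚ
            ≡⟨ cong (s ^ℚ r B * (1ℚ /ℚ s) ^ℚ r A * (F A C * G C B) *_) (^-inverse 1/s·s (r C)) ⟨
          s ^ℚ r B * (1ℚ /ℚ s) ^ℚ r A * (F A C * G C B) * ((1ℚ /ℚ s) ^ℚ r C * s ^ℚ r C)
            ≡⟨ regroup (s ^ℚ r B) ((1ℚ /ℚ s) ^ℚ r A) (s ^ℚ r C) ((1ℚ /ℚ s) ^ℚ r C) (F A C) (G C B) ⟩
          twist s F A C * twist s G C B ∎

      twist-δ : twist s δ ≈ δ
      twist-δ A B = begin
        s ^ℚ r B * (1ℚ /ℚ s) ^ℚ r A * δ A B  ≡⟨ *-comm _ (δ A B) ⟩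
        δ A B * (s ^ℚ r B * (1ℚ /ℚ s) ^ℚ r A)  ≡⟨ δ-* A B (λ X → s ^ℚ r X * (1ℚ /ℚ s) ^ℚ r A) ⟩
        δ A B * (s ^ℚ r A * (1ℚ /ℚ s) ^ℚ r A)  ≡⟨ cong (δ A B *_) (^-inverse s·1/s (r A)) ⟩
        δ A B * 1ℚ                             ≡⟨ *-identityʳ (δ A B) ⟩
        δ A B                                  ∎
        where open ≡-Reasoning

      twist-⊖ : ∀ F G → twist s (F ⊖ G) ≈ twist s F ⊖ twist s G
      twist-⊖ F G A B = distrib (s ^ℚ r B * (1ℚ /ℚ s) ^ℚ r A) (F A B) (G A B)
        where
        distrib : ∀ w f g → w * (f - g) ≡ w * f - w * g
        distrib = solve-∀ ℚ-ring

      twist-· : ∀ c F → twist s (c · F) ≈ c · twist s F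
      twist-· c F A B = swap (s ^ℚ r B * (1ℚ /ℚ s) ^ℚ r A) c (F A B)
        where
        swap : ∀ w c f → w * (c * f) ≡ c * (w * f)
        swap = solve-∀ ℚ-ring

      twist-involutive : ∀ F → twist s (twist (1ℚ /ℚ s) F) ≈ F
      twist-involutive F A B = begin
        s ^ℚ r B * (1ℚ /ℚ s) ^ℚ r A * ((1ℚ /ℚ s) ^ℚ r B * (1ℚ /ℚ (1ℚ /ℚ s)) ^ℚ r A * F A B)
          ≡⟨ regroup (s ^ℚ r B) ((1ℚ /ℚ s) ^ℚ r A) ((1ℚ /ℚ s) ^ℚ r B) ((1ℚ /ℚ (1ℚ /ℚ s)) ^ℚ r A) (F A B) ⟩
        s ^ℚ r B * (1ℚ /ℚ s) ^ℚ r B * ((1ℚ /ℚ s) ^ℚ r A * (1ℚ /ℚ (1ℚ /ℚ s)) ^ℚ r A) * F A B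
          ≡⟨ cong₂ (λ x y → x * y * F A B) (^-inverse s·1/s (r B)) (^-inverse (*-1/ℚ (1/ℚ-≢0 s≢0)) (r A)) ⟩
        1ℚ * 1ℚ * F A B
          ≡⟨ *-identityˡ (F A B) ⟩
        F A B ∎
        where
        open ≡-Reasoning
        regroup : ∀ b a b′ a′ f → b * a * (b′ * a′ * f) ≡ b * b′ * (a * a′) * f
        regroup = solve-∀ ℚ-ring

    -- For flats A ⊆ B of a matroid with rank function r, χ s A B is the characteristic
    -- polynomial of M|B/A evaluated at s.
    χ : ℚ → Kernel n
    χ s = μ ⋆ twist s ζ

    χ̄ : ℚ → Kernel n
    χ̄ s A B = 𝟙 (does (A ⊂? B)) * (χ s A B /ℚ (s - 1ℚ))

    χ̄-supported : ∀ s {A B} → ¬ A ⊂ B → χ̄ s A B ≡ 0ℚ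
    χ̄-supported s {A} {B} A⊄B = trans (cong (λ b → 𝟙 b * (χ s A B /ℚ (s - 1ℚ))) (dec-false (A ⊂? B) A⊄B)) (*-zeroˡ (χ s A B /ℚ (s - 1ℚ)))

    module _ {s : ℚ} (s≢0 : s ≢ 0ℚ) where

      private
        open ≡-Reasoning
        w : Subset n → Subset n → ℚ
        w A B = s ^ℚ r B * (1ℚ /ℚ s) ^ℚ r A
        term-swap : ∀ m u z → m * (u * z) ≡ u * (m * z)
        term-swap = solve-∀ ℚ-ring

      χ-support : ∀ A B → χ s A B ≡ ζ A B * χ s A B
      χ-support A B = begin
        ∑[ U ∈ allSubsets n ] (μ A U * (w U B * ζ U B))
          ≡⟨ ∑-factor (allSubsets n) (ζ A B) (λ U → begin
               μ A U * (w U B * ζ U B)             ≡⟨ term-swap (μ A U) (w U B) (ζ U B) ⟩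
               w U B * (μ A U * ζ U B)             ≡⟨ cong (w U B *_) (μζ-support A U B) ⟩
               w U B * (ζ A B * (μ A U * ζ U B))   ≡⟨ term-swap (w U B) (ζ A B) _ ⟩
               ζ A B * (w U B * (μ A U * ζ U B))   ≡⟨ cong (ζ A B *_) (term-swap (μ A U) (w U B) (ζ U B)) ⟨
               ζ A B * (μ A U * (w U B * ζ U B))   ∎) ⟩
        ζ A B * χ s A B ∎

      χ-diagonal : ∀ A → χ s A A ≡ 1ℚ
      χ-diagonal A = begin
        ∑[ U ∈ allSubsets n ] (μ A U * (w U A * ζ U A))
          ≡⟨ ∑-cong (allSubsets n) (λ {U} _ → trans (term-swap (μ A U) (w U A) (ζ U A))
                                              (trans (cong (w U A *_) (μζ-diagonal A U)) (*-comm (w U A) (δ A U)))) ⟩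
        ∑[ U ∈ allSubsets n ] (δ A U * w U A)
          ≡⟨ ∑-pick _≟ₛ_ (allSubsets-unique n) (∈-allSubsets A) (λ U → w U A) ⟩
        w A A
          ≡⟨ ^-inverse (*-1/ℚ s≢0) (r A) ⟩
        1ℚ ∎

      module _ (s≢1 : s ≢ 1ℚ) where

        χ-decomposition : χ s ≈ δ ⊕ (s - 1ℚ) · χ̄ s
        χ-decomposition A B = begin
          χ s A B                                         ≡⟨ χ-support A B ⟩
          ζ A B * χ s A B                                 ≡⟨ cong (_* χ s A B) (⊂-+-δ A B) ⟨
          (𝟙 (does (A ⊂? B)) + δ A B) * χ s A B           ≡⟨ *-distribʳ-+ (χ s A B) (𝟙 (does (A ⊂? B))) (δ A B) ⟩
          𝟙 (does (A ⊂? B)) * χ s A B + δ A B * χ s A B   ≡⟨ cong₂ _+_ strict diagonal ⟩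
          (s - 1ℚ) * χ̄ s A B + δ A B                      ≡⟨ +-comm _ (δ A B) ⟩
          δ A B + (s - 1ℚ) * χ̄ s A B                      ∎
          where
          strict : 𝟙 (does (A ⊂? B)) * χ s A B ≡ (s - 1ℚ) * χ̄ s A B
          strict = begin
            𝟙 (does (A ⊂? B)) * χ s A B                               ≡⟨ cong (𝟙 (does (A ⊂? B)) *_) (*-/ℚ (x-1≢0 s≢1) (χ s A B)) ⟨
            𝟙 (does (A ⊂? B)) * ((s - 1ℚ) * (χ s A B /ℚ (s - 1ℚ)))   ≡⟨ term-swap (𝟙 (does (A ⊂? B))) (s - 1ℚ) _ ⟩
            (s - 1ℚ) * χ̄ s A B                                        ∎
          diagonal : δ A B * χ s A B ≡ δ A B
          diagonal = trans (δ-* A B (χ s A)) (trans (cong (δ A B *_) (χ-diagonal A)) (*-identityʳ (δ A B)))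

        χ̄-from-χ : χ̄ s ≈ (1ℚ /ℚ (s - 1ℚ)) · (χ s ⊖ δ)
        χ̄-from-χ A B = sym (begin
          c * (χ s A B - δ A B)                       ≡⟨ cong (λ t → c * (t - δ A B)) (χ-decomposition A B) ⟩
          c * ((δ A B + (s - 1ℚ) * χ̄ s A B) - δ A B)  ≡⟨ cancel (δ A B) (s - 1ℚ) c (χ̄ s A B) ⟩
          (s - 1ℚ) * c * χ̄ s A B                      ≡⟨ cong (_* χ̄ s A B) (*-1/ℚ (x-1≢0 s≢1)) ⟩
          1ℚ * χ̄ s A B                                ≡⟨ *-identityˡ (χ̄ s A B) ⟩
          χ̄ s A B                                     ∎)
          where
          c = 1ℚ /ℚ (s - 1ℚ)
          cancel : ∀ d k c x → c * ((d + k * x) - d) ≡ k * c * x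
          cancel = solve-∀ ℚ-ring

    module Poincaré (s : ℚ) = Chains.ChainSum (⊂-isDecStrictPartialOrder n) (χ̄ s) (χ̄-supported s)

    -- On a pair of flats A ⊆ B, P s A B is the Poincaré polynomial of the minor M|B/A
    -- (for the empty flag) evaluated at s.
    P : ℚ → Kernel n
    P s = Poincaré.chainSum s (allSubsets n)

    module _ (s : ℚ) where

      private
        open ≡-Reasoning
        telescope : ∀ d x p y → (d - x) + (p - y) ≡ d + ((p - x) - y)
        telescope = solve-∀ ℚ-ring

      δ⊕P-⋆-δ⊖χ̄ : (δ ⊕ P s) ⋆ (δ ⊖ χ̄ s) ≈ δ
      δ⊕P-⋆-δ⊖χ̄ A B = begin
        ((δ ⊕ P s) ⋆ (δ ⊖ χ̄ s)) A B
          ≡⟨ ⊕-⋆ δ (P s) (δ ⊖ χ̄ s) A B ⟩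
        (δ ⋆ (δ ⊖ χ̄ s)) A B + (P s ⋆ (δ ⊖ χ̄ s)) A B
          ≡⟨ cong₂ _+_ (δ-⋆ (δ ⊖ χ̄ s) A B) (⋆-⊖ (P s) δ (χ̄ s) A B) ⟩
        (δ A B - χ̄ s A B) + ((P s ⋆ δ) A B - (P s ⋆ χ̄ s) A B)
          ≡⟨ cong (λ t → (δ A B - χ̄ s A B) + (t - (P s ⋆ χ̄ s) A B)) (⋆-δ (P s) A B) ⟩
        (δ A B - χ̄ s A B) + (P s A B - (P s ⋆ χ̄ s) A B)
          ≡⟨ telescope (δ A B) (χ̄ s A B) (P s A B) ((P s ⋆ χ̄ s) A B) ⟩
        δ A B + ((P s A B - χ̄ s A B) - (P s ⋆ χ̄ s) A B)
          ≡⟨ cong (λ t → δ A B + ((t - χ̄ s A B) - (P s ⋆ χ̄ s) A B)) (Poincaré.chainSum-last-step s (allSubsets n) A B) ⟩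
        δ A B + (((χ̄ s A B + (P s ⋆ χ̄ s) A B) - χ̄ s A B) - (P s ⋆ χ̄ s) A B)
          ≡⟨ cong (δ A B +_) (vanish (χ̄ s A B) ((P s ⋆ χ̄ s) A B)) ⟩
        δ A B + 0ℚ
          ≡⟨ +-identityʳ (δ A B) ⟩
        δ A B ∎
        where
        vanish : ∀ x y → ((x + y) - x) - y ≡ 0ℚ
        vanish = solve-∀ ℚ-ring

      δ⊖χ̄-⋆-δ⊕P : (δ ⊖ χ̄ s) ⋆ (δ ⊕ P s) ≈ δ
      δ⊖χ̄-⋆-δ⊕P A B = begin
        ((δ ⊖ χ̄ s) ⋆ (δ ⊕ P s)) A B
          ≡⟨ ⊖-⋆ δ (χ̄ s) (δ ⊕ P s) A B ⟩
        (δ ⋆ (δ ⊕ P s)) A B - (χ̄ s ⋆ (δ ⊕ P s)) A B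
          ≡⟨ cong₂ _-_ (δ-⋆ (δ ⊕ P s) A B) (⋆-⊕ (χ̄ s) δ (P s) A B) ⟩
        (δ A B + P s A B) - ((χ̄ s ⋆ δ) A B + (χ̄ s ⋆ P s) A B)
          ≡⟨ cong (λ t → (δ A B + P s A B) - (t + (χ̄ s ⋆ P s) A B)) (⋆-δ (χ̄ s) A B) ⟩
        (δ A B + P s A B) - (χ̄ s A B + (χ̄ s ⋆ P s) A B)
          ≡⟨ cong (λ t → (δ A B + t) - (χ̄ s A B + (χ̄ s ⋆ P s) A B)) (Poincaré.chainSum-first-step s (allSubsets n) A B) ⟩
        (δ A B + (χ̄ s A B + (χ̄ s ⋆ P s) A B)) - (χ̄ s A B + (χ̄ s ⋆ P s) A B)
          ≡⟨ vanish (δ A B) (χ̄ s A B + (χ̄ s ⋆ P s) A B) ⟩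
        δ A B ∎
        where
        vanish : ∀ d x → (d + x) - x ≡ d
        vanish = solve-∀ ℚ-ring

    module _ {s : ℚ} (s≢0 : s ≢ 0ℚ) where

      χ-⋆-twisted-χ : χ s ⋆ twist s (χ (1ℚ /ℚ s)) ≈ δ
      χ-⋆-twisted-χ = begin
        χ s ⋆ twist s (μ ⋆ twist (1ℚ /ℚ s) ζ)                  ≈⟨ ⋆-congˡ (χ s) (twist-⋆ s≢0 μ (twist (1ℚ /ℚ s) ζ)) ⟩
        χ s ⋆ (twist s μ ⋆ twist s (twist (1ℚ /ℚ s) ζ))        ≈⟨ ⋆-congˡ (χ s) (⋆-congˡ (twist s μ) (twist-involutive s≢0 ζ)) ⟩
        (μ ⋆ twist s ζ) ⋆ (twist s μ ⋆ ζ)                     ≈⟨ ⋆-assoc μ (twist s ζ) (twist s μ ⋆ ζ) ⟩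
        μ ⋆ (twist s ζ ⋆ (twist s μ ⋆ ζ))                     ≈⟨ ⋆-congˡ μ (⋆-assoc (twist s ζ) (twist s μ) ζ) ⟨
        μ ⋆ ((twist s ζ ⋆ twist s μ) ⋆ ζ)                     ≈⟨ ⋆-congˡ μ (⋆-congʳ ζ (twist-⋆ s≢0 ζ μ)) ⟨
        μ ⋆ (twist s (ζ ⋆ μ) ⋆ ζ)                             ≈⟨ ⋆-congˡ μ (⋆-congʳ ζ (twist-cong s≢0 ζ⋆μ≈δ)) ⟩
        μ ⋆ (twist s δ ⋆ ζ)                                   ≈⟨ ⋆-congˡ μ (⋆-congʳ ζ (twist-δ s≢0)) ⟩
        μ ⋆ (δ ⋆ ζ)                                           ≈⟨ ⋆-congˡ μ (δ-⋆ ζ) ⟩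
        μ ⋆ ζ                                                 ≈⟨ μ⋆ζ≈δ ⟩
        δ                                                     ∎
        where open SetoidReasoning ≈-setoid

    module _ {s : ℚ} (s≢0 : s ≢ 0ℚ) (s≢1 : s ≢ 1ℚ) where

      private
        p = 1ℚ /ℚ s
        p≢0 : p ≢ 0ℚ
        p≢0 = 1/ℚ-≢0 s≢0
        p≢1 : p ≢ 1ℚ
        p≢1 = 1/ℚ-≢1 s≢0 s≢1
        D : Kernel n
        D = twist s (χ p)

      δ⊖χ̄-⋆-twisted-χ : (δ ⊖ χ̄ s) ⋆ D ≈ twist s (δ ⊖ χ̄ p)
      δ⊖χ̄-⋆-twisted-χ A B = begin
        ((δ ⊖ χ̄ s) ⋆ D) A B
          ≡⟨ ⊖-⋆ δ (χ̄ s) D A B ⟩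
        (δ ⋆ D) A B - (χ̄ s ⋆ D) A B
          ≡⟨ cong₂ _-_ (δ-⋆ D A B) (⋆-congʳ D (χ̄-from-χ s≢0 s≢1) A B) ⟩
        D A B - ((c · (χ s ⊖ δ)) ⋆ D) A B
          ≡⟨ cong (λ t → D A B - t) (trans (·-⋆ c (χ s ⊖ δ) D A B) (cong (c *_) (⊖-⋆ (χ s) δ D A B))) ⟩
        D A B - c * ((χ s ⋆ D) A B - (δ ⋆ D) A B)
          ≡⟨ cong₂ (λ x y → D A B - c * (x - y)) (χ-⋆-twisted-χ s≢0 A B) (δ-⋆ D A B) ⟩
        D A B - c * (δ A B - D A B)
          ≡⟨ swap-sides (D A B) (δ A B) c c′ (1/[x-1]+1/[1/x-1] s≢0 s≢1) ⟩
        δ A B - c′ * (D A B - δ A B)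
          ≡⟨ cong₂ (λ x y → x - c′ * (D A B - y)) (twist-δ s≢0 A B) (twist-δ s≢0 A B) ⟨
        twist s δ A B - c′ * (D A B - twist s δ A B)
          ≡⟨ cong (λ t → twist s δ A B - t) (trans (twist-· s≢0 c′ (χ p ⊖ δ) A B) (cong (c′ *_) (twist-⊖ s≢0 (χ p) δ A B))) ⟨
        twist s δ A B - twist s (c′ · (χ p ⊖ δ)) A B
          ≡⟨ cong (λ t → twist s δ A B - t) (twist-cong s≢0 (χ̄-from-χ p≢0 p≢1) A B) ⟨
        twist s δ A B - twist s (χ̄ p) A B
          ≡⟨ twist-⊖ s≢0 δ (χ̄ p) A B ⟨
        twist s (δ ⊖ χ̄ p) A B ∎
        where
        open ≡-Reasoning
        c = 1ℚ /ℚ (s - 1ℚ)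
        c′ = 1ℚ /ℚ (p - 1ℚ)
        swap-sides : ∀ x d c c′ → c + c′ ≡ - 1ℚ → x - c * (d - x) ≡ d - c′ * (x - d)
        swap-sides x d c c′ c+c′≡-1 = begin
          x - c * (d - x)                  ≡⟨ rearrange x d c c′ ⟩
          d - c′ * (x - d) + (1ℚ + (c + c′)) * (x - d)  ≡⟨ cong (λ t → d - c′ * (x - d) + (1ℚ + t) * (x - d)) c+c′≡-1 ⟩
          d - c′ * (x - d) + (1ℚ + - 1ℚ) * (x - d)      ≡⟨ drop (d - c′ * (x - d)) (x - d) ⟩
          d - c′ * (x - d)                 ∎
          where
          rearrange : ∀ x d c c′ → x - c * (d - x) ≡ d - c′ * (x - d) + (1ℚ + (c + c′)) * (x - d)
          rearrange = solve-∀ ℚ-ring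
          drop : ∀ y z → y + (1ℚ + - 1ℚ) * z ≡ y
          drop = solve-∀ ℚ-ring

      -- The right-hand side is a left inverse of twist s (δ ⊖ χ̄ p) (by δ⊖χ̄-⋆-twisted-χ) and
      -- the left-hand side a right inverse (twisting is multiplicative), so the two agree.
      twist-δ⊕P : twist s (δ ⊕ P p) ≈ χ s ⋆ (δ ⊕ P s)
      twist-δ⊕P = begin
        twist s (δ ⊕ P p)                                       ≈⟨ δ-⋆ (twist s (δ ⊕ P p)) ⟨
        δ ⋆ twist s (δ ⊕ P p)                                   ≈⟨ ⋆-congʳ (twist s (δ ⊕ P p)) R-⋆-twisted-N ⟨
        (R ⋆ twist s (δ ⊖ χ̄ p)) ⋆ twist s (δ ⊕ P p)            ≈⟨ ⋆-assoc R (twist s (δ ⊖ χ̄ p)) (twist s (δ ⊕ P p)) ⟩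
        R ⋆ (twist s (δ ⊖ χ̄ p) ⋆ twist s (δ ⊕ P p))            ≈⟨ ⋆-congˡ R (twist-⋆ s≢0 (δ ⊖ χ̄ p) (δ ⊕ P p)) ⟨
        R ⋆ twist s ((δ ⊖ χ̄ p) ⋆ (δ ⊕ P p))                    ≈⟨ ⋆-congˡ R (twist-cong s≢0 (δ⊖χ̄-⋆-δ⊕P p)) ⟩
        R ⋆ twist s δ                                           ≈⟨ ⋆-congˡ R (twist-δ s≢0) ⟩
        R ⋆ δ                                                   ≈⟨ ⋆-δ R ⟩
        R                                                       ∎
        where
        open SetoidReasoning ≈-setoid
        R = χ s ⋆ (δ ⊕ P s)
        R-⋆-twisted-N : R ⋆ twist s (δ ⊖ χ̄ p) ≈ δ
        R-⋆-twisted-N = begin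
          R ⋆ twist s (δ ⊖ χ̄ p)                          ≈⟨ ⋆-congˡ R δ⊖χ̄-⋆-twisted-χ ⟨
          R ⋆ ((δ ⊖ χ̄ s) ⋆ D)                            ≈⟨ ⋆-assoc (χ s) (δ ⊕ P s) ((δ ⊖ χ̄ s) ⋆ D) ⟩
          χ s ⋆ ((δ ⊕ P s) ⋆ ((δ ⊖ χ̄ s) ⋆ D))            ≈⟨ ⋆-congˡ (χ s) (⋆-assoc (δ ⊕ P s) (δ ⊖ χ̄ s) D) ⟨
          χ s ⋆ (((δ ⊕ P s) ⋆ (δ ⊖ χ̄ s)) ⋆ D)            ≈⟨ ⋆-congˡ (χ s) (⋆-congʳ D (δ⊕P-⋆-δ⊖χ̄ s)) ⟩
          χ s ⋆ (δ ⋆ D)                                  ≈⟨ ⋆-congˡ (χ s) (δ-⋆ D) ⟩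
          χ s ⋆ D                                        ≈⟨ χ-⋆-twisted-χ s≢0 ⟩
          δ                                              ∎

      P-palindromic : ∀ {A B} → A ⊂ B → s ^ℚ r B * p ^ℚ r A * P p A B ≡ s * P s A B
      P-palindromic {A} {B} A⊂B = begin
        s ^ℚ r B * p ^ℚ r A * P p A B                         ≡⟨ cong (s ^ℚ r B * p ^ℚ r A *_) (+-identityˡ (P p A B)) ⟨
        s ^ℚ r B * p ^ℚ r A * (0ℚ + P p A B)                  ≡⟨ cong (λ t → s ^ℚ r B * p ^ℚ r A * (t + P p A B)) δAB≡0 ⟨
        twist s (δ ⊕ P p) A B                                  ≡⟨ twist-δ⊕P A B ⟩
        (χ s ⋆ (δ ⊕ P s)) A B                                  ≡⟨ ⋆-⊕ (χ s) δ (P s) A B ⟩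
        (χ s ⋆ δ) A B + (χ s ⋆ P s) A B                        ≡⟨ cong₂ _+_ (⋆-δ (χ s) A B) (⋆-congʳ (P s) (χ-decomposition s≢0 s≢1) A B) ⟩
        χ s A B + ((δ ⊕ (s - 1ℚ) · χ̄ s) ⋆ P s) A B            ≡⟨ cong₂ _+_ (χ-decomposition s≢0 s≢1 A B) (⊕-⋆ δ ((s - 1ℚ) · χ̄ s) (P s) A B) ⟩
        (δ A B + (s - 1ℚ) * χ̄ s A B) + ((δ ⋆ P s) A B + (((s - 1ℚ) · χ̄ s) ⋆ P s) A B)
          ≡⟨ cong₂ (λ x y → (δ A B + (s - 1ℚ) * χ̄ s A B) + (x + y)) (δ-⋆ (P s) A B) (·-⋆ (s - 1ℚ) (χ̄ s) (P s) A B) ⟩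
        (δ A B + (s - 1ℚ) * χ̄ s A B) + (P s A B + (s - 1ℚ) * (χ̄ s ⋆ P s) A B)
          ≡⟨ cong₂ (λ x y → (x + (s - 1ℚ) * χ̄ s A B) + (y + (s - 1ℚ) * (χ̄ s ⋆ P s) A B)) δAB≡0 (Poincaré.chainSum-first-step s (allSubsets n) A B) ⟩
        (0ℚ + (s - 1ℚ) * χ̄ s A B) + ((χ̄ s A B + (χ̄ s ⋆ P s) A B) + (s - 1ℚ) * (χ̄ s ⋆ P s) A B)
          ≡⟨ collect s (χ̄ s A B) ((χ̄ s ⋆ P s) A B) ⟩
        s * (χ̄ s A B + (χ̄ s ⋆ P s) A B)
          ≡⟨ cong (s *_) (Poincaré.chainSum-first-step s (allSubsets n) A B) ⟨
        s * P s A B ∎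
        where
        open ≡-Reasoning
        δAB≡0 : δ A B ≡ 0ℚ
        δAB≡0 = cong 𝟙 (dec-false (A ≟ₛ B) (λ { refl → ⊂-irref refl A⊂B }))
        collect : ∀ s x y → (0ℚ + (s - 1ℚ) * x) + ((x + y) + (s - 1ℚ) * y) ≡ s * (x + y)
        collect = solve-∀ ℚ-ring

module Flats where

  open import Data.Bool using (Bool; false)
  open import Data.Empty using (⊥-elim)
  open import Data.Fin using (Fin; zero; suc)
  import Data.Fin.Properties as Fin
  open import Data.Fin.Subset using (Subset; _∪_; _∩_; ⁅_⁆; ⊥; ⊤; _∈_; _∉_; _⊆_; _⊂_)
  open import Data.Fin.Subset.Properties
    using (_∈?_; _⊂?_; ⊂-isDecStrictPartialOrder; ⊆-antisym; x∈p∪q⁻; x∈p∪q⁺; x∈p∩q⁺; x∈⁅y⁆⇒x≡y; p⊆p∪q; ∪-identityˡ; ∣⊥∣≡0; ∉⊥; ∈⊤; ⊆⊤; ⊆-⊂-trans)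
  open import Data.List using (List; []; _∷_; filter; length)
  open import Data.List.Properties using (filter-accept; filter-reject)
  open import Data.List.Relation.Unary.All using (All; []; _∷_)
  open import Data.Nat using (ℕ; zero; suc; _≤_; _<_; z≤n; s≤s) renaming (_+_ to _+ℕ_)
  open import Data.Nat.Properties as ℕ using (+-suc; +-monoʳ-≤; <-≤-trans; <⇒≱; ≮⇒≥; n≤0⇒n≡0; +-cancelʳ-≤; +-mono-≤; +-monoˡ-≤; +-comm; ≤-antisym)
  open import Data.Product using (_×_; _,_; ∃-syntax)
  open import Data.Rational using (ℚ; 0ℚ; 1ℚ; _+_; _*_; _-_)
  open import Data.Rational.Properties using (*-zeroˡ; *-zeroʳ; *-comm; *-assoc; *-identityʳ; +-identityʳ)
  open import Data.Sum using (inj₁; inj₂)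
  open import Data.Vec using (tabulate; _∷_; [])
  open import Function using (_∘_)
  open import Relation.Binary.PropositionalEquality
  open import Relation.Nullary using (yes; no; ¬_)
  open import Relation.Nullary.Decidable using (¬?; _→-dec_; ⌊_⌋)

  open import Defs
  open Rational
  open BigOperators
  open Incidence
  open Duality

  module _ {n : ℕ} (M : Matroid n) where

    private
      r : Subset n → ℕ
      r = rank M

    loop-persists : ∀ {A U e} → A ⊆ U → r (A ∪ ⁅ e ⁆) ≤ r A → r (U ∪ ⁅ e ⁆) ≡ r U
    loop-persists {A} {U} {e} A⊆U loop = ≤-antisym (+-cancelʳ-≤ (r A) (r (U ∪ ⁅ e ⁆)) (r U) submodular) (rank-mono M U _ (p⊆p∪q ⁅ e ⁆))
      where
      open ℕ.≤-Reasoning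
      U∪e⊆ : U ∪ ⁅ e ⁆ ⊆ (A ∪ ⁅ e ⁆) ∪ U
      U∪e⊆ x∈ with x∈p∪q⁻ U ⁅ e ⁆ x∈
      ... | inj₁ x∈U = x∈p∪q⁺ (inj₂ x∈U)
      ... | inj₂ x∈e = x∈p∪q⁺ (inj₁ (x∈p∪q⁺ (inj₂ x∈e)))
      A⊆ : A ⊆ (A ∪ ⁅ e ⁆) ∩ U
      A⊆ x∈A = x∈p∩q⁺ (x∈p∪q⁺ (inj₁ x∈A) , A⊆U x∈A)
      submodular : r (U ∪ ⁅ e ⁆) +ℕ r A ≤ r U +ℕ r A
      submodular = begin
        r (U ∪ ⁅ e ⁆) +ℕ r A                          ≤⟨ +-mono-≤ (rank-mono M _ _ U∪e⊆) (rank-mono M _ _ A⊆) ⟩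
        r ((A ∪ ⁅ e ⁆) ∪ U) +ℕ r ((A ∪ ⁅ e ⁆) ∩ U)    ≤⟨ rank-submod M (A ∪ ⁅ e ⁆) U ⟩
        r (A ∪ ⁅ e ⁆) +ℕ r U                          ≤⟨ +-monoˡ-≤ (r U) loop ⟩
        r A +ℕ r U                                    ≡⟨ +-comm (r A) (r U) ⟩
        r U +ℕ r A                                    ∎

    non-flat⇒loop : ∀ {X} → ¬ IsFlat M X → ∃[ e ] e ∉ X × r (X ∪ ⁅ e ⁆) ≤ r X
    non-flat⇒loop {X} ¬flat with Fin.¬∀⟶∃¬ n _ (λ e → ¬? (e ∈? X) →-dec (r X ℕ.<? r (X ∪ ⁅ e ⁆))) ¬flat
    ... | e , ¬rises with e ∈? X
    ...   | yes e∈X = ⊥-elim (¬rises (λ e∉X → ⊥-elim (e∉X e∈X)))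
    ...   | no  e∉X = e , e∉X , ≮⇒≥ (λ rises → ¬rises (λ _ → rises))

    flat-contains-loop : ∀ {A B e} → IsFlat M B → A ⊆ B → r (A ∪ ⁅ e ⁆) ≤ r A → e ∈ B
    flat-contains-loop {A} {B} {e} B-flat A⊆B loop with e ∈? B
    ... | yes e∈B = e∈B
    ... | no  e∉B = ⊥-elim (<⇒≱ (B-flat e e∉B) (ℕ.≤-reflexive (loop-persists A⊆B loop)))

    flat-< : ∀ {A B} → IsFlat M A → A ⊂ B → r A < r B
    flat-< {A} {B} A-flat (A⊆B , e , e∈B , e∉A) = <-≤-trans (A-flat e e∉A) (rank-mono M _ _ A∪e⊆B)
      where
      A∪e⊆B : A ∪ ⁅ e ⁆ ⊆ B
      A∪e⊆B x∈ with x∈p∪q⁻ A ⁅ e ⁆ x∈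
      ... | inj₁ x∈A = A⊆B x∈A
      ... | inj₂ x∈e = subst (_∈ B) (sym (x∈⁅y⁆⇒x≡y e x∈e)) e∈B

    r⊥≡0 : r ⊥ ≡ 0
    r⊥≡0 = n≤0⇒n≡0 (subst (r ⊥ ≤_) (∣⊥∣≡0 n) (rank-bound M ⊥))

    cl⊥≡⊥ : Loopless M → cl M ⊥ ≡ ⊥
    cl⊥≡⊥ loopless = tabulate-false no-loop
      where
      no-loop : ∀ e → ⌊ rank M (⊥ ∪ ⁅ e ⁆) ℕ.≟ rank M ⊥ ⌋ ≡ false
      no-loop e with rank M (⊥ ∪ ⁅ e ⁆) ℕ.≟ rank M ⊥
      ... | no  _    = refl
      ... | yes loop with () ← trans (sym (loopless e)) (trans (cong r (sym (∪-identityˡ ⁅ e ⁆))) (trans loop r⊥≡0))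
      tabulate-false : ∀ {m} {f : Fin m → Bool} → (∀ e → f e ≡ false) → tabulate f ≡ ⊥
      tabulate-false {zero}  f≡false = refl
      tabulate-false {suc m} f≡false = cong₂ _∷_ (f≡false zero) (tabulate-false (f≡false ∘ suc))

    module _ (s : ℚ) where

      χ-vanishes : ∀ {A B} → A ⊆ B → IsFlat M B → ¬ IsFlat M A → χ r s A B ≡ 0ℚ
      χ-vanishes {A} {B} A⊆B B-flat ¬A-flat with non-flat⇒loop ¬A-flat
      ... | e , e∉A , loop = trans (∑-cong (allSubsets n) (λ {U} _ → cong (μ A U *_) (*-comm (g U) (ζ U B))))
                                   (∑-μζ-toggle g A⊆B e∉A (flat-contains-loop B-flat A⊆B loop) toggle)
        where
        g : Subset n → ℚ
        g U = s ^ℚ r B * (1ℚ /ℚ s) ^ℚ r U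
        toggle : ∀ U → A ⊆ U → g (U ∪ ⁅ e ⁆) ≡ g U
        toggle U A⊆U = cong (λ k → s ^ℚ r B * (1ℚ /ℚ s) ^ℚ k) (loop-persists A⊆U loop)

      χ̄-vanishes : ∀ {A B} → IsFlat M B → ¬ IsFlat M A → χ̄ r s A B ≡ 0ℚ
      χ̄-vanishes {A} {B} B-flat ¬A-flat with A ⊂? B
      ... | no  _          = *-zeroˡ (χ r s A B /ℚ (s - 1ℚ))
      ... | yes (A⊆B , _) = begin
        1ℚ * (χ r s A B /ℚ (s - 1ℚ))  ≡⟨ cong (λ x → 1ℚ * (x /ℚ (s - 1ℚ))) (χ-vanishes A⊆B B-flat ¬A-flat) ⟩
        1ℚ * (0ℚ /ℚ (s - 1ℚ))         ≡⟨ cong (1ℚ *_) (0/ℚ (s - 1ℚ)) ⟩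
        1ℚ * 0ℚ                       ≡⟨⟩
        0ℚ                            ∎
        where open ≡-Reasoning

      private
        module C = Poincaré r s

      chainSum-from-non-flat : ∀ L {x B} → IsFlat M B → ¬ IsFlat M x → C.chainSum L x B ≡ 0ℚ
      chainSum-from-non-flat []      B-flat ¬x-flat = χ̄-vanishes B-flat ¬x-flat
      chainSum-from-non-flat (y ∷ L) {x} {B} B-flat ¬x-flat with isFlat? M y
      ... | yes y-flat = begin
        C.chainSum L x B + C.chainSum L x y * C.chainSum L y B
          ≡⟨ cong₂ (λ u v → u + v * C.chainSum L y B) (chainSum-from-non-flat L B-flat ¬x-flat) (chainSum-from-non-flat L y-flat ¬x-flat) ⟩
        0ℚ + 0ℚ * C.chainSum L y B
          ≡⟨ cong (0ℚ +_) (*-zeroˡ (C.chainSum L y B)) ⟩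
        0ℚ ∎
        where open ≡-Reasoning
      ... | no ¬y-flat = begin
        C.chainSum L x B + C.chainSum L x y * C.chainSum L y B
          ≡⟨ cong₂ (λ u v → u + C.chainSum L x y * v) (chainSum-from-non-flat L B-flat ¬x-flat) (chainSum-from-non-flat L B-flat ¬y-flat) ⟩
        0ℚ + C.chainSum L x y * 0ℚ
          ≡⟨ cong (0ℚ +_) (*-zeroʳ (C.chainSum L x y)) ⟩
        0ℚ ∎
        where open ≡-Reasoning

      module _ (loopless : Loopless M) where

        chainSum-nFlats : ∀ L {A B} → IsFlat M B → C.chainSum (filter (isNFlat? M) L) A B ≡ C.chainSum L A B
        chainSum-nFlats []      B-flat = refl
        chainSum-nFlats (y ∷ L) {A} {B} B-flat with isNFlat? M y
        ... | yes y-nflat@(y-flat , _ , _) = begin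
          C.chainSum (filter (isNFlat? M) (y ∷ L)) A B      ≡⟨ cong (λ L′ → C.chainSum L′ A B) (filter-accept (isNFlat? M) y-nflat) ⟩
          C.chainSum (y ∷ filter (isNFlat? M) L) A B        ≡⟨ cong₂ _+_ (chainSum-nFlats L B-flat)
                                                                 (cong₂ _*_ (chainSum-nFlats L y-flat) (chainSum-nFlats L B-flat)) ⟩
          C.chainSum (y ∷ L) A B                            ∎
          where open ≡-Reasoning
        ... | no ¬y-nflat = begin
          C.chainSum (filter (isNFlat? M) (y ∷ L)) A B      ≡⟨ cong (λ L′ → C.chainSum L′ A B) (filter-reject (isNFlat? M) ¬y-nflat) ⟩
          C.chainSum (filter (isNFlat? M) L) A B            ≡⟨ chainSum-nFlats L B-flat ⟩
          C.chainSum L A B                                  ≡⟨ +-identityʳ _ ⟨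
          C.chainSum L A B + 0ℚ                             ≡⟨ cong (C.chainSum L A B +_) rejected ⟨
          C.chainSum L A B + C.chainSum L A y * C.chainSum L y B ∎
          where
          open ≡-Reasoning
          rejected : C.chainSum L A y * C.chainSum L y B ≡ 0ℚ
          rejected with isFlat? M y | y ≟ₛ ⊤
          ... | no ¬y-flat | _ = trans (cong (C.chainSum L A y *_) (chainSum-from-non-flat L B-flat ¬y-flat)) (*-zeroʳ (C.chainSum L A y))
          ... | yes _ | yes refl = trans (cong (C.chainSum L A ⊤ *_) (C.chainSum-supported L ⊤⊄B)) (*-zeroʳ (C.chainSum L A ⊤))
            where
            ⊤⊄B : ¬ ⊤ ⊂ B
            ⊤⊄B (_ , x , _ , x∉⊤) = x∉⊤ ∈⊤
          ... | yes y-flat | no y≢⊤ = trans (cong (_* C.chainSum L y B) (C.chainSum-supported L A⊄y)) (*-zeroˡ (C.chainSum L y B))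
            where
            A⊄y : ¬ A ⊂ y
            A⊄y A⊂y = ¬y-nflat (y-flat , subst (_⊂ y) (sym (cl⊥≡⊥ loopless)) (⊆-⊂-trans (λ x∈⊥ → ⊥-elim (∉⊥ x∈⊥)) A⊂y) , y≢⊤)

    ⊥-flat : Loopless M → IsFlat M ⊥
    ⊥-flat loopless e _ = subst₂ _<_ (sym r⊥≡0) (sym (trans (cong r (∪-identityˡ ⁅ e ⁆)) (loopless e))) (s≤s z≤n)

    ⊤-flat : IsFlat M ⊤
    ⊤-flat e e∉⊤ = ⊥-elim (e∉⊤ ∈⊤)

    nFlat-between : Loopless M → ∀ {F} → IsNFlat M F → ⊥ ⊂ F × F ⊂ ⊤
    nFlat-between loopless {F} (_ , cl⊥⊂F , F≢⊤) = subst (_⊂ F) (cl⊥≡⊥ loopless) cl⊥⊂F , (⊆⊤ , missing)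
      where
      missing : ∃[ e ] e ∈ ⊤ × e ∉ F
      missing with Fin.¬∀⟶∃¬ n (_∈ F) (_∈? F) (λ all∈F → F≢⊤ (⊆-antisym ⊆⊤ (λ {e} _ → all∈F e)))
      ... | e , e∉F = e , ∈⊤ , e∉F

    module _ where
      open Chains (⊂-isDecStrictPartialOrder n) using (Ascending; end; _↗_)

      ascending-rank : ∀ {A Q B} → Ascending A Q B → IsFlat M A → All (IsFlat M) Q → suc (length Q) +ℕ r A ≤ r B
      ascending-rank (end A⊂B)        A-flat []                = flat-< A-flat A⊂B
      ascending-rank {A} {H ∷ Q} (A⊂H ↗ H↗B) A-flat (H-flat ∷ Q-flat) = begin
        suc (suc (length Q)) +ℕ r A     ≡⟨ +-suc (suc (length Q)) (r A) ⟨
        suc (length Q) +ℕ suc (r A)     ≤⟨ +-monoʳ-≤ (suc (length Q)) (flat-< A-flat A⊂H) ⟩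
        suc (length Q) +ℕ r H           ≤⟨ ascending-rank H↗B H-flat Q-flat ⟩
        r _                             ∎
        where open ℕ.≤-Reasoning

    module _ (loopless : Loopless M) {s : ℚ} (s≢0 : s ≢ 0ℚ) (s≢1 : s ≢ 1ℚ) where
      open Chains (⊂-isDecStrictPartialOrder n) using (Ascending; end; _↗_)

      private
        p = 1ℚ /ℚ s
        module Cs = Poincaré r s
        module Cp = Poincaré r p

      chainSum-palindromic : ∀ {A B} → A ⊂ B → IsFlat M B →
        s ^ℚ r B * p ^ℚ r A * Cp.chainSum (nFlats M) A B ≡ s * Cs.chainSum (nFlats M) A B
      chainSum-palindromic {A} {B} A⊂B B-flat = begin
        s ^ℚ r B * p ^ℚ r A * Cp.chainSum (nFlats M) A B  ≡⟨ cong (s ^ℚ r B * p ^ℚ r A *_) (chainSum-nFlats p loopless (allSubsets n) B-flat) ⟩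
        s ^ℚ r B * p ^ℚ r A * P r p A B                   ≡⟨ P-palindromic r s≢0 s≢1 A⊂B ⟩
        s * P r s A B                                     ≡⟨ cong (s *_) (chainSum-nFlats s loopless (allSubsets n) B-flat) ⟨
        s * Cs.chainSum (nFlats M) A B                    ∎
        where open ≡-Reasoning

      chainSumThrough-palindromic : ∀ {A Q B} → Ascending A Q B → All (IsFlat M) Q → IsFlat M B →
        s ^ℚ r B * p ^ℚ r A * Cp.chainSumThrough (nFlats M) A Q B ≡ s ^ℚ suc (length Q) * Cs.chainSumThrough (nFlats M) A Q B
      chainSumThrough-palindromic {A} {[]} {B} (end A⊂B) [] B-flat = begin
        s ^ℚ r B * p ^ℚ r A * (Cp.chainSum (nFlats M) A B * 1ℚ)  ≡⟨ *-assoc (s ^ℚ r B * p ^ℚ r A) (Cp.chainSum (nFlats M) A B) 1ℚ ⟨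
        s ^ℚ r B * p ^ℚ r A * Cp.chainSum (nFlats M) A B * 1ℚ    ≡⟨ cong (_* 1ℚ) (chainSum-palindromic A⊂B B-flat) ⟩
        s * Cs.chainSum (nFlats M) A B * 1ℚ                      ≡⟨ regroup s (Cs.chainSum (nFlats M) A B) ⟩
        s * 1ℚ * (Cs.chainSum (nFlats M) A B * 1ℚ)               ∎
        where
        open ≡-Reasoning
        regroup : ∀ s c → s * c * 1ℚ ≡ s * 1ℚ * (c * 1ℚ)
        regroup = solve-∀ ℚ-ring
      chainSumThrough-palindromic {A} {H ∷ Q} {B} (A⊂H ↗ H↗B) (H-flat ∷ Q-flat) B-flat = begin
        s ^ℚ r B * p ^ℚ r A * (Cp.chainSum (nFlats M) A H * Cp.chainSumThrough (nFlats M) H Q B)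
          ≡⟨ telescope (s ^ℚ r B) (p ^ℚ r A) (s ^ℚ r H) (p ^ℚ r H) _ _ (^-inverse (trans (*-comm p s) (*-1/ℚ s≢0)) (r H)) ⟩
        (s ^ℚ r H * p ^ℚ r A * Cp.chainSum (nFlats M) A H) * (s ^ℚ r B * p ^ℚ r H * Cp.chainSumThrough (nFlats M) H Q B)
          ≡⟨ cong₂ _*_ (chainSum-palindromic A⊂H H-flat) (chainSumThrough-palindromic H↗B Q-flat B-flat) ⟩
        (s * Cs.chainSum (nFlats M) A H) * (s ^ℚ suc (length Q) * Cs.chainSumThrough (nFlats M) H Q B)
          ≡⟨ regroup s (Cs.chainSum (nFlats M) A H) (s ^ℚ suc (length Q)) _ ⟩
        s ^ℚ suc (suc (length Q)) * (Cs.chainSum (nFlats M) A H * Cs.chainSumThrough (nFlats M) H Q B) ∎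
        where
        open ≡-Reasoning
        telescope : ∀ sB pA sH pH x y → pH * sH ≡ 1ℚ → sB * pA * (x * y) ≡ (sH * pA * x) * (sB * pH * y)
        telescope sB pA sH pH x y pH*sH≡1 = begin
          sB * pA * (x * y)                           ≡⟨ *-identityʳ _ ⟨
          sB * pA * (x * y) * 1ℚ                      ≡⟨ cong (sB * pA * (x * y) *_) pH*sH≡1 ⟨
          sB * pA * (x * y) * (pH * sH)               ≡⟨ shuffle sB pA sH pH x y ⟩
          (sH * pA * x) * (sB * pH * y)               ∎
          where
          shuffle : ∀ sB pA sH pH x y → sB * pA * (x * y) * (pH * sH) ≡ (sH * pA * x) * (sB * pH * y)
          shuffle = solve-∀ ℚ-ring
        regroup : ∀ s a t b → (s * a) * (t * b) ≡ s * t * (a * b)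
        regroup = solve-∀ ℚ-ring

module FlagMatroid where

  open import Data.Fin.Subset using (Subset; _∪_; _∩_; ∁; ⊥; ⊤; ⋃; _∈_; _∉_; _⊆_; _⊂_; ∣_∣)
  open import Data.Fin.Subset.Properties
    using (_∈?_; _⊂?_; ⊂-isDecStrictPartialOrder; ⊂-irref; ⊂-asymmetric; ⊆-antisym; p⊆p∪q; x∈p∪q⁻; x∈p∪q⁺; x∈p∩q⁺; x∈p∩q⁻;


           x∈∁p⇒x∉p; x∉p⇒x∈∁p; ∪-isCommutativeMonoid; ∪-identityˡ; ∪-identityʳ; ∪-assoc; ∪-comm; ∪-distribʳ-∩; ∪-inverseˡ; ∩-identityˡ; ∩-identityʳ; ∈⊤; ∉⊥)
  open import Data.List using (List; []; _∷_; _++_; map; foldr; filter; length)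
  open import Data.List.Properties using (filter-accept; filter-reject; filter-none; map-cong; map-cong-local)
  import Data.List.Relation.Unary.All as All
  import Data.List.Membership.Propositional.Properties as ∈ₗ
  open import Data.List.Relation.Unary.All using (All; []; _∷_)
  open import Data.List.Membership.Propositional using () renaming (_∈_ to _∈ₗ_)
  open import Data.List.Relation.Unary.Any using (here; there)
  open import Data.Nat using (ℕ; suc; _≤_; _∸_; z≤n) renaming (_+_ to _+ℕ_)
  open import Data.Nat.Properties using (∸-monoˡ-≤; +-mono-≤)
  open import Data.Product using (_×_; _,_; proj₁; proj₂; uncurry)
  open import Data.Sum using (inj₁; inj₂)
  open import Data.Rational using (ℚ; 0ℚ; 1ℚ; _*_; _-_; -_)
  open import Data.Rational.Properties using (*-comm; *-identityˡ; *-identityʳ; *-assoc)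
  open import Relation.Binary.PropositionalEquality
  open import Relation.Nullary using (Dec; yes; no; ¬_)
  open import Relation.Nullary.Decidable using (dec-true)
  open import Data.List.Relation.Binary.Permutation.Propositional using (_↭_; ↭⇒↭ₛ)
  import Data.List.Relation.Binary.Permutation.Propositional.Properties as ↭
  open import Data.Nat.ListAction.Properties using (sum-↭)

  open import Defs
  open Rational
  open BigOperators
  open Incidence
  open Duality

  module _ {n : ℕ} where
    open Chains (⊂-isDecStrictPartialOrder n) using (Ascending; end; _↗_; ascending⇒<∈; ascending⇒<; gaps)

    ∪-absorbs-⊆ : ∀ {a b : Subset n} → a ⊆ b → a ∪ b ≡ b
    ∪-absorbs-⊆ {a} {b} a⊆b = ⊆-antisym a∪b⊆b (λ x∈b → x∈p∪q⁺ (inj₂ x∈b))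
      where
      a∪b⊆b : a ∪ b ⊆ b
      a∪b⊆b x∈ with x∈p∪q⁻ a b x∈
      ... | inj₁ x∈a = a⊆b x∈a
      ... | inj₂ x∈b = x∈b

    zbelow-first : ∀ {a H Q b} → Ascending a (H ∷ Q) b → zbelow (H ∷ Q) H ≡ ⊥
    zbelow-first {H = H} {Q} (_ ↗ H↗b) = cong ⋃ (trans (filter-reject (_⊂? H) (⊂-irref refl))
      (filter-none (_⊂? H) (all-above Q (ascending⇒<∈ H↗b))))
      where
      all-above : ∀ ys → (∀ {y} → y ∈ₗ ys → H ⊂ y) → All (λ y → ¬ y ⊂ H) ys
      all-above []       _    = []
      all-above (y ∷ ys) H<_ = (λ y⊂H → ⊂-asymmetric y⊂H (H< here refl)) ∷ all-above ys (λ y∈ys → H< there y∈ys)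

    zbelow-below : ∀ {H G : Subset n} (Q : List (Subset n)) → H ⊂ G → zbelow (H ∷ Q) G ≡ H ∪ zbelow Q G
    zbelow-below {H} {G} Q H⊂G = cong ⋃ (filter-accept (_⊂? G) H⊂G)

    zbelow-gaps : ∀ {X : Set} (k : Subset n → Subset n → X) {a Q b} → Ascending a Q b →
      map (λ G → k (a ∪ zbelow Q G) G) (Q ++ b ∷ []) ≡ map (uncurry k) (gaps a Q b)
    zbelow-gaps k {a} {[]}    {b} _ = cong (λ Z → k Z b ∷ []) (∪-identityʳ a)
    zbelow-gaps k {a} {H ∷ Q} {b} a↗b@(a⊂H ↗ H↗b) = cong₂ _∷_ first rest
      where
      first : k (a ∪ zbelow (H ∷ Q) H) H ≡ k a H
      first = cong (λ Z → k Z H) (trans (cong (a ∪_) (zbelow-first a↗b)) (∪-identityʳ a))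
      above-H : ∀ {G} → G ∈ₗ Q ++ b ∷ [] → H ⊂ G
      above-H G∈ with ∈ₗ.∈-++⁻ Q G∈
      ... | inj₁ G∈Q        = ascending⇒<∈ H↗b G∈Q
      ... | inj₂ (here refl) = ascending⇒< H↗b
      shift : ∀ {G} → G ∈ₗ Q ++ b ∷ [] → a ∪ zbelow (H ∷ Q) G ≡ H ∪ zbelow Q G
      shift {G} G∈ = begin
        a ∪ zbelow (H ∷ Q) G     ≡⟨ cong (a ∪_) (zbelow-below Q (above-H G∈)) ⟩
        a ∪ (H ∪ zbelow Q G)     ≡⟨ ∪-assoc a H (zbelow Q G) ⟨
        (a ∪ H) ∪ zbelow Q G     ≡⟨ cong (_∪ zbelow Q G) (∪-absorbs-⊆ (proj₁ a⊂H)) ⟩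
        H ∪ zbelow Q G           ∎
        where open ≡-Reasoning
      rest : map (λ G → k (a ∪ zbelow (H ∷ Q) G) G) (Q ++ b ∷ []) ≡ map (uncurry k) (gaps H Q b)
      rest = trans (map-cong-local (All.tabulate (λ {G} G∈ → cong (λ Z → k Z G) (shift G∈)))) (zbelow-gaps k H↗b)

    blocks-partition : ∀ {a Q b e} → Ascending a Q b → e ∈ b →
      let count = length (filter (λ g → e ∈? (proj₂ g ∩ ∁ (proj₁ g))) (gaps a Q b))
      in (e ∈ a → count ≡ 0) × (e ∉ a → count ≡ 1)
    blocks-partition {a} {[]} {b} {e} (end _) e∈b =
        (λ e∈a → cong length (filter-reject (λ g → e ∈? (proj₂ g ∩ ∁ (proj₁ g))) (λ e∈b∖a → x∈∁p⇒x∉p (proj₂ (x∈p∩q⁻ b (∁ a) e∈b∖a)) e∈a)))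
      , (λ e∉a → cong length (filter-accept (λ g → e ∈? (proj₂ g ∩ ∁ (proj₁ g))) (x∈p∩q⁺ (e∈b , x∉p⇒x∈∁p e∉a))))
    blocks-partition {a} {H ∷ Q} {b} {e} (a⊂H ↗ H↗b) e∈b =
        (λ e∈a → trans (cong length (filter-reject block? (λ e∈H∖a → x∈∁p⇒x∉p (proj₂ (x∈p∩q⁻ H (∁ a) e∈H∖a)) e∈a)))
                       (proj₁ (blocks-partition H↗b e∈b) (proj₁ a⊂H e∈a)))
      , λ e∉a → once e∉a (e ∈? H)
      where
      block? = λ (g : Subset n × Subset n) → e ∈? (proj₂ g ∩ ∁ (proj₁ g))
      once : e ∉ a → Dec (e ∈ H) → length (filter block? (gaps a (H ∷ Q) b)) ≡ 1
      once e∉a (yes e∈H) = trans (cong length (filter-accept block? (x∈p∩q⁺ (e∈H , x∉p⇒x∈∁p e∉a))))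
                                 (cong suc (proj₁ (blocks-partition H↗b e∈b) e∈H))
      once e∉a (no  e∉H) = trans (cong length (filter-reject block? (λ e∈H∖a → e∉H (proj₁ (x∈p∩q⁻ H (∁ a) e∈H∖a)))))
                                 (proj₂ (blocks-partition H↗b e∈b) e∉H)

  module _ {n : ℕ} (M : Matroid n) where
    import Data.List.Relation.Binary.Permutation.Setoid.Properties (setoid (Subset n)) as ↭ₛ
    open Chains (⊂-isDecStrictPartialOrder n) using (Ascending; gaps; gaps-<; length-gaps)

    private
      r : Subset n → ℕ
      r = rank M

    gapRank : Subset n → Subset n → Subset n → ℕ
    gapRank c d X = minorRank M d c (X ∩ (d ∩ ∁ c))

    rankFlagMatroid-gaps : ∀ {Q} → Ascending ⊥ Q ⊤ → ∀ X →
      rankFlagMatroid M Q X ≡ foldr _+ℕ_ 0 (map (uncurry λ c d → gapRank c d X) (gaps ⊥ Q ⊤))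
    rankFlagMatroid-gaps {Q} ⊥↗⊤ X = cong (foldr _+ℕ_ 0) (trans
      (map-cong (λ G → cong (λ Z → minorRank M G Z (X ∩ (G ∩ ∁ Z))) (sym (∪-identityˡ (zbelow Q G)))) (Q ++ ⊤ ∷ []))
      (zbelow-gaps (λ Z G → minorRank M G Z (X ∩ (G ∩ ∁ Z))) ⊥↗⊤))

    gapRank-≤ : ∀ c d X → gapRank c d X ≤ gapRank c d ⊤
    gapRank-≤ c d X = ∸-monoˡ-≤ (r c) (rank-mono M _ _ ⊆-⊤-part)
      where
      ⊆-⊤-part : (X ∩ (d ∩ ∁ c)) ∪ c ⊆ (⊤ ∩ (d ∩ ∁ c)) ∪ c
      ⊆-⊤-part x∈ with x∈p∪q⁻ (X ∩ (d ∩ ∁ c)) c x∈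
      ... | inj₁ x∈X∩ = x∈p∪q⁺ (inj₁ (x∈p∩q⁺ (∈⊤ , proj₂ (x∈p∩q⁻ X _ x∈X∩))))
      ... | inj₂ x∈c  = x∈p∪q⁺ (inj₂ x∈c)

    ⊤-part : ∀ {c d : Subset n} → c ⊆ d → (⊤ ∩ (d ∩ ∁ c)) ∪ c ≡ d
    ⊤-part {c} {d} c⊆d = begin
      (⊤ ∩ (d ∩ ∁ c)) ∪ c      ≡⟨ cong (_∪ c) (∩-identityˡ (d ∩ ∁ c)) ⟩
      (d ∩ ∁ c) ∪ c            ≡⟨ ∪-distribʳ-∩ c d (∁ c) ⟩
      (d ∪ c) ∩ (∁ c ∪ c)      ≡⟨ cong ((d ∪ c) ∩_) (∪-inverseˡ c) ⟩
      (d ∪ c) ∩ ⊤              ≡⟨ ∩-identityʳ (d ∪ c) ⟩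
      d ∪ c                    ≡⟨ ∪-comm d c ⟩
      c ∪ d                    ≡⟨ ∪-absorbs-⊆ c⊆d ⟩
      d                        ∎
      where open ≡-Reasoning

    module _ {q : ℚ} (q≢0 : q ≢ 0ℚ) where

      private
        p = 1ℚ /ℚ q
        qp≡1 : q * p ≡ 1ℚ
        qp≡1 = *-1/ℚ q≢0
        pq≡1 : p * q ≡ 1ℚ
        pq≡1 = trans (*-comm p q) qp≡1
        block : Subset n × Subset n → Subset n
        block g = proj₂ g ∩ ∁ (proj₁ g)
        gapFactor : Subset n × Subset n → Subset n → ℚ
        gapFactor g Y = q ^ℚ gapRank (proj₁ g) (proj₂ g) ⊤ * p ^ℚ (r (Y ∪ proj₁ g) ∸ r (proj₁ g))
        totalRank : List (Subset n × Subset n) → Subset n → ℕ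
        totalRank gs X = foldr _+ℕ_ 0 (map (uncurry λ c d → gapRank c d X) gs)

        totalRank-≤ : ∀ gs X → totalRank gs X ≤ totalRank gs ⊤
        totalRank-≤ []             X = z≤n
        totalRank-≤ ((c , d) ∷ gs) X = +-mono-≤ (gapRank-≤ c d X) (totalRank-≤ gs X)

        term-factorises : ∀ gs X → (- 1ℚ) ^ℚ ∣ X ∣ * q ^ℚ (totalRank gs ⊤ ∸ totalRank gs X)
                                     ≡ μ ⊥ X * ∏[ g ∈ gs ] gapFactor g (X ∩ block g)
        term-factorises gs X = cong₂ _*_ (sym (μ-⊥ X)) (begin
          q ^ℚ (totalRank gs ⊤ ∸ totalRank gs X)
            ≡⟨ ^-∸ pq≡1 (totalRank-≤ gs X) ⟩
          q ^ℚ totalRank gs ⊤ * p ^ℚ totalRank gs X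
            ≡⟨ cong₂ _*_ (^-∑ q gs (uncurry λ c d → gapRank c d ⊤)) (^-∑ p gs (uncurry λ c d → gapRank c d X)) ⟩
          ∏[ g ∈ gs ] (q ^ℚ gapRank (proj₁ g) (proj₂ g) ⊤) * ∏[ g ∈ gs ] (p ^ℚ gapRank (proj₁ g) (proj₂ g) X)
            ≡⟨ ∏-* gs _ _ ⟩
          ∏[ g ∈ gs ] gapFactor g (X ∩ block g) ∎)
          where open ≡-Reasoning

        gapFactor-shift : ∀ {c d} → c ⊆ d → ∀ X → gapFactor (c , d) X ≡ q ^ℚ r d * p ^ℚ r (X ∪ c)
        gapFactor-shift {c} {d} c⊆d X = begin
          q ^ℚ (r ((⊤ ∩ (d ∩ ∁ c)) ∪ c) ∸ r c) * p ^ℚ (r (X ∪ c) ∸ r c)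
            ≡⟨ cong (λ Z → q ^ℚ (r Z ∸ r c) * p ^ℚ (r (X ∪ c) ∸ r c)) (⊤-part c⊆d) ⟩
          q ^ℚ (r d ∸ r c) * p ^ℚ (r (X ∪ c) ∸ r c)
            ≡⟨ cong₂ _*_ (^-∸ pq≡1 (rank-mono M c d c⊆d)) (^-∸ qp≡1 (rank-mono M c (X ∪ c) (λ x∈c → x∈p∪q⁺ (inj₂ x∈c)))) ⟩
          q ^ℚ r d * p ^ℚ r c * (p ^ℚ r (X ∪ c) * q ^ℚ r c)
            ≡⟨ interchange (q ^ℚ r d) (p ^ℚ r c) (p ^ℚ r (X ∪ c)) (q ^ℚ r c) ⟩
          q ^ℚ r d * p ^ℚ r (X ∪ c) * (p ^ℚ r c * q ^ℚ r c)
            ≡⟨ cong (q ^ℚ r d * p ^ℚ r (X ∪ c) *_) (^-inverse pq≡1 (r c)) ⟩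
          q ^ℚ r d * p ^ℚ r (X ∪ c) * 1ℚ
            ≡⟨ *-identityʳ _ ⟩
          q ^ℚ r d * p ^ℚ r (X ∪ c) ∎
          where
          open ≡-Reasoning
          interchange : ∀ w x y z → w * x * (y * z) ≡ w * y * (x * z)
          interchange = solve-∀ ℚ-ring

        gap-sum : ∀ {c d} → c ⊆ d → ∑[ X ∈ allSubsets n ] (μ ⊥ X * (ζ X (d ∩ ∁ c) * gapFactor (c , d) X)) ≡ χ r q c d
        gap-sum {c} {d} c⊆d = begin
          ∑[ X ∈ allSubsets n ] (μ ⊥ X * (ζ X (d ∩ ∁ c) * gapFactor (c , d) X))
            ≡⟨ ∑-cong (allSubsets n) (λ {X} _ → cong (λ t → μ ⊥ X * (ζ X (d ∩ ∁ c) * t)) (gapFactor-shift c⊆d X)) ⟩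
          ∑[ X ∈ allSubsets n ] (μ ⊥ X * (ζ X (d ∩ ∁ c) * (q ^ℚ r d * p ^ℚ r (X ∪ c))))
            ≡⟨ ∑-shift c d (λ U → q ^ℚ r d * p ^ℚ r U) c⊆d ⟩
          ∑[ U ∈ allSubsets n ] (μ c U * (ζ U d * (q ^ℚ r d * p ^ℚ r U)))
            ≡⟨ ∑-cong (allSubsets n) (λ {U} _ → cong (μ c U *_) (*-comm (ζ U d) _)) ⟩
          χ r q c d ∎
          where open ≡-Reasoning

      charPoly-gaps : ∀ {Q} → Ascending ⊥ Q ⊤ → charPolyRank (rankFlagMatroid M Q) q ≡ ∏[ g ∈ gaps ⊥ Q ⊤ ] χ r q (proj₁ g) (proj₂ g)
      charPoly-gaps {Q} ⊥↗⊤ = begin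
        ∑[ X ∈ allSubsets n ] ((- 1ℚ) ^ℚ ∣ X ∣ * q ^ℚ (rankFlagMatroid M Q ⊤ ∸ rankFlagMatroid M Q X))
          ≡⟨ ∑-cong (allSubsets n) (λ {X} _ → cong (λ k → (- 1ℚ) ^ℚ ∣ X ∣ * q ^ℚ k)
               (cong₂ _∸_ (rankFlagMatroid-gaps ⊥↗⊤ ⊤) (rankFlagMatroid-gaps ⊥↗⊤ X))) ⟩
        ∑[ X ∈ allSubsets n ] ((- 1ℚ) ^ℚ ∣ X ∣ * q ^ℚ (totalRank gs ⊤ ∸ totalRank gs X))
          ≡⟨ ∑-cong (allSubsets n) (λ {X} _ → term-factorises gs X) ⟩
        ∑[ X ∈ allSubsets n ] (μ ⊥ X * ∏[ g ∈ gs ] gapFactor g (X ∩ block g))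
          ≡⟨ ∑-μ⊥-∏ gs block gapFactor (λ e → proj₂ (blocks-partition ⊥↗⊤ ∈⊤) ∉⊥) ⟩
        ∏[ g ∈ gs ] ∑[ X ∈ allSubsets n ] (μ ⊥ X * (ζ X (block g) * gapFactor g X))
          ≡⟨ ∏-cong gs (λ g∈gs → gap-sum (proj₁ (gaps-< ⊥↗⊤ g∈gs))) ⟩
        ∏[ g ∈ gs ] χ r q (proj₁ g) (proj₂ g) ∎
        where
        open ≡-Reasoning
        gs = gaps ⊥ Q ⊤

    weight : ℚ → List (Subset n) → ℚ
    weight q 𝓖 = redCharPolyRank (rankFlagMatroid M 𝓖) q /ℚ ((q - 1ℚ) ^ℚ length 𝓖)

    weight-ascending : ∀ {q Q} → q ≢ 0ℚ → q ≢ 1ℚ → Ascending ⊥ Q ⊤ →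
      weight q Q ≡ ∏[ g ∈ gaps ⊥ Q ⊤ ] χ̄ r q (proj₁ g) (proj₂ g)
    weight-ascending {q} {Q} q≢0 q≢1 ⊥↗⊤ = begin
      (charPolyRank (rankFlagMatroid M Q) q /ℚ (q - 1ℚ)) /ℚ ((q - 1ℚ) ^ℚ length Q)
        ≡⟨ cong (λ x → (x /ℚ (q - 1ℚ)) /ℚ ((q - 1ℚ) ^ℚ length Q)) (charPoly-gaps q≢0 ⊥↗⊤) ⟩
      (∏ gs χ-gap /ℚ (q - 1ℚ)) /ℚ ((q - 1ℚ) ^ℚ length Q)
        ≡⟨ trans (/ℚ-≡-*-1/ℚ (∏ gs χ-gap /ℚ (q - 1ℚ)) ((q - 1ℚ) ^ℚ length Q))
                 (cong₂ _*_ (/ℚ-≡-*-1/ℚ (∏ gs χ-gap) (q - 1ℚ)) (1/ℚ-^ (x-1≢0 q≢1) (length Q))) ⟩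
      ∏ gs χ-gap * c * c ^ℚ length Q
        ≡⟨ *-assoc (∏ gs χ-gap) c _ ⟩
      ∏ gs χ-gap * c ^ℚ suc (length Q)
        ≡⟨ cong (λ k → ∏ gs χ-gap * c ^ℚ k) (length-gaps ⊥ Q ⊤) ⟨
      ∏ gs χ-gap * c ^ℚ length gs
        ≡⟨ ∏-*-const gs χ-gap c ⟨
      ∏[ g ∈ gs ] (χ-gap g * c)
        ≡⟨ ∏-cong gs (λ g∈gs → reduced (gaps-< ⊥↗⊤ g∈gs)) ⟩
      ∏[ g ∈ gs ] χ̄ r q (proj₁ g) (proj₂ g) ∎
      where
      open ≡-Reasoning
      gs = gaps ⊥ Q ⊤
      c = 1ℚ /ℚ (q - 1ℚ)
      χ-gap : Subset n × Subset n → ℚ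
      χ-gap g = χ r q (proj₁ g) (proj₂ g)
      reduced : ∀ {g} → proj₁ g ⊂ proj₂ g → χ-gap g * c ≡ χ̄ r q (proj₁ g) (proj₂ g)
      reduced {g} c⊂d = begin
        χ-gap g * c                                       ≡⟨ /ℚ-≡-*-1/ℚ (χ-gap g) (q - 1ℚ) ⟨
        χ-gap g /ℚ (q - 1ℚ)                               ≡⟨ *-identityˡ _ ⟨
        1ℚ * (χ-gap g /ℚ (q - 1ℚ))                        ≡⟨ cong (λ b → 𝟙 b * (χ-gap g /ℚ (q - 1ℚ))) (dec-true (proj₁ g ⊂? proj₂ g) c⊂d) ⟨
        χ̄ r q (proj₁ g) (proj₂ g)                         ∎

    rankFlagMatroid-↭ : ∀ {𝓖 𝓖′} → 𝓖 ↭ 𝓖′ → ∀ X → rankFlagMatroid M 𝓖 X ≡ rankFlagMatroid M 𝓖′ X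
    rankFlagMatroid-↭ {𝓖} {𝓖′} 𝓖↭𝓖′ X = trans
      (cong (foldr _+ℕ_ 0) (map-cong (λ G → cong (λ Z → minorRank M G Z (X ∩ (G ∩ ∁ Z))) (zbelow-↭ G)) (𝓖 ++ ⊤ ∷ [])))
      (sum-↭ (↭.map⁺ (λ G → minorRank M G (zbelow 𝓖′ G) (X ∩ (G ∩ ∁ (zbelow 𝓖′ G)))) (↭.++⁺ʳ (⊤ ∷ []) 𝓖↭𝓖′)))
      where
      zbelow-↭ : ∀ G → zbelow 𝓖 G ≡ zbelow 𝓖′ G
      zbelow-↭ G = ↭ₛ.foldr-commMonoid (∪-isCommutativeMonoid n) (↭⇒↭ₛ (↭.filter-↭ (_⊂? G) 𝓖↭𝓖′))

    weight-↭ : ∀ q {𝓖 𝓖′} → 𝓖 ↭ 𝓖′ → weight q 𝓖 ≡ weight q 𝓖′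
    weight-↭ q 𝓖↭𝓖′ = cong₂ (λ χ k → (χ /ℚ (q - 1ℚ)) /ℚ ((q - 1ℚ) ^ℚ k))
      (∑-cong (allSubsets n) (λ {X} _ → cong (λ k → (- 1ℚ) ^ℚ ∣ X ∣ * q ^ℚ k)
        (cong₂ _∸_ (rankFlagMatroid-↭ 𝓖↭𝓖′ ⊤) (rankFlagMatroid-↭ 𝓖↭𝓖′ X))))
      (↭.↭-length 𝓖↭𝓖′)

module PoincarePolynomial where

  open import Data.Fin using (zero)
  open import Data.Fin.Subset using (Subset; ⊥; ⊤)
  open import Data.Fin.Subset.Properties using (_⊂?_; ⊂-isDecStrictPartialOrder; ⊆⊤; ∈⊤; ∉⊥)
  open import Data.List using (List; length)
  import Data.List.Membership.Propositional.Properties as ∈ₗ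
  open import Data.List.Relation.Binary.Permutation.Propositional using (_↭_; ↭-sym)
  open import Data.List.Relation.Binary.Permutation.Propositional.Properties using (All-resp-↭)
  open import Data.List.Relation.Unary.All as All using (All; all?)
  open import Data.List.Relation.Unary.AllPairs using (allPairs?)
  open import Data.List.Relation.Unary.Unique.Propositional using (Unique)
  import Data.List.Relation.Unary.Unique.Propositional.Properties as Unique
  open import Data.Nat using (ℕ; suc; _≤_; _∸_; s≤s) renaming (_+_ to _+ℕ_)
  open import Data.Nat.Properties using (+-identityʳ)
  open import Data.Product using (_×_; _,_; proj₁; proj₂; ∃-syntax)
  open import Data.Rational using (0ℚ; 1ℚ; _*_)
  open import Data.Rational.Properties using (*-identityˡ; *-identityʳ; *-assoc; *-comm)
  open import Relation.Binary.PropositionalEquality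
  open import Relation.Nullary.Decidable using (_×-dec_; _⊎-dec_)

  open import Defs
  open Rational
  open BigOperators
  open Incidence
  open Duality
  open Flats
  open FlagMatroid

  module _ {n : ℕ} (M : Matroid n) (loopless : Loopless M) where
    open Chains (⊂-isDecStrictPartialOrder n) using (Ascending; sort)
    open import Data.List.Membership.DecPropositional (_≟ₛ_ {n}) using (_∈?_)

    private
      r : Subset n → ℕ
      r = rank M

    nFlats-unique : Unique (nFlats M)
    nFlats-unique = Unique.filter⁺ (isNFlat? M) (allSubsets-unique n)

    poincare≡chainSumThrough : ∀ {q} → q ≢ 0ℚ → q ≢ 1ℚ → ∀ {𝓕 Q} → All (IsNFlat M) 𝓕 → Ascending ⊥ Q ⊤ → Q ↭ 𝓕 →
      poincare M 𝓕 q ≡ Poincaré.chainSumThrough r q (nFlats M) ⊥ Q ⊤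
    poincare≡chainSumThrough {q} q≢0 q≢1 {𝓕} 𝓕-nflats ⊥↗⊤ Q↭𝓕 = trans
      (∑-filter good? (sublists (nFlats M)) (weight M q))
      (Poincaré.∑-sublists-chains r q (weight M q) (weight-↭ M q) (weight-ascending M q≢0 q≢1) 𝓕 good?
        (nFlats M) nFlats-unique
        (All.tabulate (λ F∈ → nFlat-between M loopless (proj₂ (∈ₗ.∈-filter⁻ (isNFlat? M) {xs = allSubsets n} F∈))))
        (All.map (λ F-nflat → ∈ₗ.∈-filter⁺ (isNFlat? M) (∈-allSubsets _) F-nflat) 𝓕-nflats)
        ⊥↗⊤ Q↭𝓕)
      where
      good? = λ 𝓖 → allPairs? (λ A B → (A ⊂? B) ⊎-dec (B ⊂? A)) 𝓖 ×-dec all? (λ F → F ∈? 𝓖) 𝓕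

    chainSumThrough-reciprocal : ∀ {q Q} → q ≢ 0ℚ → q ≢ 1ℚ → Ascending ⊥ Q ⊤ → All (IsFlat M) Q →
      Poincaré.chainSumThrough r (1ℚ /ℚ q) (nFlats M) ⊥ Q ⊤
        ≡ (1ℚ /ℚ q) ^ℚ (r ⊤ ∸ suc (length Q)) * Poincaré.chainSumThrough r q (nFlats M) ⊥ Q ⊤
    chainSumThrough-reciprocal {q} {Q} q≢0 q≢1 ⊥↗⊤ Q-flat = begin
      Tp                                          ≡⟨ *-identityˡ Tp ⟨
      1ℚ * Tp                                     ≡⟨ cong (_* Tp) (^-inverse pq≡1 (r ⊤)) ⟨
      p ^ℚ r ⊤ * q ^ℚ r ⊤ * Tp                    ≡⟨ cong (λ t → p ^ℚ r ⊤ * t * Tp) (*-identityʳ (q ^ℚ r ⊤)) ⟨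
      p ^ℚ r ⊤ * (q ^ℚ r ⊤ * 1ℚ) * Tp             ≡⟨ cong (λ k → p ^ℚ r ⊤ * (q ^ℚ r ⊤ * p ^ℚ k) * Tp) (r⊥≡0 M) ⟨
      p ^ℚ r ⊤ * (q ^ℚ r ⊤ * p ^ℚ r ⊥) * Tp       ≡⟨ *-assoc (p ^ℚ r ⊤) _ Tp ⟩
      p ^ℚ r ⊤ * (q ^ℚ r ⊤ * p ^ℚ r ⊥ * Tp)       ≡⟨ cong (p ^ℚ r ⊤ *_) (chainSumThrough-palindromic M loopless q≢0 q≢1 ⊥↗⊤ Q-flat (⊤-flat M)) ⟩
      p ^ℚ r ⊤ * (q ^ℚ suc (length Q) * Tq)       ≡⟨ *-assoc (p ^ℚ r ⊤) _ Tq ⟨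
      p ^ℚ r ⊤ * q ^ℚ suc (length Q) * Tq         ≡⟨ cong (_* Tq) (^-∸ {p} {q} (*-1/ℚ q≢0) rank-gap) ⟨
      p ^ℚ (r ⊤ ∸ suc (length Q)) * Tq            ∎
      where
      open ≡-Reasoning
      p = 1ℚ /ℚ q
      pq≡1 : p * q ≡ 1ℚ
      pq≡1 = trans (*-comm p q) (*-1/ℚ q≢0)
      Tp = Poincaré.chainSumThrough r p (nFlats M) ⊥ Q ⊤
      Tq = Poincaré.chainSumThrough r q (nFlats M) ⊥ Q ⊤
      rank-gap : suc (length Q) ≤ r ⊤
      rank-gap = subst (_≤ r ⊤) (trans (cong (suc (length Q) +ℕ_) (r⊥≡0 M)) (+-identityʳ _))
                         (ascending-rank M ⊥↗⊤ (⊥-flat M loopless) Q-flat)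

    flag-ascending : 1 ≤ n → ∀ {𝓕} → IsFlagᵒ M 𝓕 → ∃[ Q ] Ascending ⊥ Q ⊤ × All (IsFlat M) Q × Q ↭ 𝓕
    flag-ascending (s≤s _) {𝓕} (𝓕-nflats , 𝓕-chain)
      with sort 𝓕 𝓕-chain (All.map (nFlat-between M loopless) 𝓕-nflats) (⊆⊤ , zero , ∈⊤ , ∉⊥)
    ... | Q , ⊥↗⊤ , 𝓕↭Q = Q , ⊥↗⊤ , All-resp-↭ 𝓕↭Q (All.map proj₁ 𝓕-nflats) , ↭-sym 𝓕↭Q

open import Defs
open import Data.Nat using (ℕ; _≤_; _∸_)
open import Data.List using (List; length)
open import Data.Fin.Subset using (Subset)
open import Data.Rational using (ℚ; 0ℚ; 1ℚ; _*_)
open import Relation.Binary.PropositionalEquality using (_≡_; _≢_)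
open import Data.Fin.Subset using (⊤)
open import Data.List.Relation.Binary.Permutation.Propositional.Properties using (↭-length)
open import Data.Nat using (suc)
open import Data.Nat.Properties using (∸-+-assoc)
open import Data.Product using (_,_)
open import Relation.Binary.PropositionalEquality using (cong; cong₂; sym; trans; module ≡-Reasoning)
open Rational using (1/ℚ-≢0; 1/ℚ-≢1)
open Duality using (module Poincaré)
open PoincarePolynomial

theorem4p1 : (n : ℕ) → 1 ≤ n → (M : Matroid n) → Loopless M →
    (𝓕 : List (Subset n)) → IsFlagᵒ M 𝓕 →
    (q : ℚ) → q ≢ 0ℚ → q ≢ 1ℚ →
    poincare M 𝓕 (1ℚ /ℚ q)
      ≡ ((1ℚ /ℚ q) ^ℚ (rk M ∸ 1 ∸ length 𝓕)) * poincare M 𝓕 q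
theorem4p1 n 1≤n M loopless 𝓕 𝓕-flag@(𝓕-nflats , _) q q≢0 q≢1 with flag-ascending M loopless 1≤n 𝓕-flag
... | Q , ⊥↗⊤ , Q-flat , Q↭𝓕 = begin
  poincare M 𝓕 p
    ≡⟨ poincare≡chainSumThrough M loopless p≢0 p≢1 𝓕-nflats ⊥↗⊤ Q↭𝓕 ⟩
  Poincaré.chainSumThrough (rank M) p (nFlats M) _ Q ⊤
    ≡⟨ chainSumThrough-reciprocal M loopless q≢0 q≢1 ⊥↗⊤ Q-flat ⟩
  p ^ℚ (rank M ⊤ ∸ suc (length Q)) * Poincaré.chainSumThrough (rank M) q (nFlats M) _ Q ⊤
    ≡⟨ cong₂ (λ k t → p ^ℚ k * t) exponent (poincare≡chainSumThrough M loopless q≢0 q≢1 𝓕-nflats ⊥↗⊤ Q↭𝓕) ⟨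
  p ^ℚ (rk M ∸ 1 ∸ length 𝓕) * poincare M 𝓕 q ∎
  where
  open ≡-Reasoning
  p = 1ℚ /ℚ q
  p≢0 = 1/ℚ-≢0 q≢0
  p≢1 = 1/ℚ-≢1 q≢0 q≢1
  exponent : rk M ∸ 1 ∸ length 𝓕 ≡ rank M ⊤ ∸ suc (length Q)
  exponent = trans (∸-+-assoc (rk M) 1 (length 𝓕)) (cong (λ k → rank M ⊤ ∸ suc k) (sym (↭-length Q↭𝓕)))
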